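{- Let $D$ be the derivation of $\mathbb Q[p,q][J,s,t,x,y]$ with $D(p)=D(q)=0$ and $D(J)=pJ(s+qt)$, $D(s)=D(t)=D(x)=D(y)=(1+q)xy$. Then for every $n\ge0$, $$D^n(J)=J\,B_n(x,y,s,t,p,q).$$
   Context: $B_n$ is the group of signed permutations of $\pm[n]$ ($\sigma(-i)=-\sigma(i)$). For $\sigma\in B_n$, $i\in[n]$ is an excedance if $\sigma(|\sigma(i)|)>\sigma(i)$, an anti-excedance if $\sigma(|\sigma(i)|)<\sigma(i)$, a fixed point if $\sigma(i)=i$, a singleton if $\sigma(i)=-i$; ${\rm exc},{\rm aexc},{\rm fix},{\rm st}$ count these; $N(\sigma)=\#\{i:\sigma(i)<0\}$; ${\rm cyc}(\sigma)$ is the number of cycles of the permutation $i\mapsto|\sigma(i)|$ of $[n]$. $B_n(x,y,s,t,p,q)=\sum_{\sigma\in B_n}x^{{\rm exc}}y^{{\rm aexc}}s^{{\rm fix}}t^{{\rm st}}p^{{\rm cyc}}q^{N}$, $B_0=1$. A derivation is a linear map with $D(uv)=D(u)v+uD(v)$. -}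

module Defs where

open import Data.Nat as ℕ using (ℕ; zero; suc)
open import Data.Fin as Fin using (Fin; toℕ)
open import Data.Bool using (Bool; true; false; if_then_else_; _∧_; not)
open import Data.Integer as ℤ using (ℤ; +_; -[1+_])
open import Data.Rational as ℚ using (ℚ)
open import Data.Vec as Vec using (Vec; []; _∷_; lookup; zipWith; replicate)
open import Data.Vec.Properties using (≡-dec)
open import Data.List as List using (List; []; _∷_; _++_; concatMap; map; filter; allFin; length)
open import Data.Product using (_×_; _,_)
open import Relation.Nullary using (does)
open import Relation.Binary.PropositionalEquality using (_≡_)

-- A monomial is its exponent vector, in the variable order
--   index 0 = J, 1 = s, 2 = t, 3 = x, 4 = y, 5 = p, 6 = q.
-- A polynomial is represented by a finite list of terms (coefficient, monomial);
-- two representations denote the same polynomial iff all coefficients agree.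

Mon : Set
Mon = Vec ℕ 7

Poly : Set
Poly = List (ℚ × Mon)

coeff : Poly → Mon → ℚ
coeff [] m = ℚ.0ℚ
coeff ((c , e) ∷ P) m =
  if does (≡-dec ℕ._≟_ e m) then c ℚ.+ coeff P m else coeff P m

infix 4 _≈_
_≈_ : Poly → Poly → Set
P ≈ Q = ∀ m → coeff P m ≡ coeff Q m

0P : Poly
0P = []

constP : ℚ → Poly
constP c = (c , replicate 7 0) ∷ []

1P : Poly
1P = constP ℚ.1ℚ

infixl 6 _⊕_
infixl 7 _⊗_

_⊕_ : Poly → Poly → Poly
P ⊕ Q = P ++ Q

_⊗_ : Poly → Poly → Poly
P ⊗ Q = concatMap (λ { (a , m) → map (λ { (b , k) → (a ℚ.* b , zipWith ℕ._+_ m k) }) Q }) P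

scale : ℚ → Poly → Poly
scale c P = map (λ { (a , m) → (c ℚ.* a , m) }) P

var : Fin 7 → Poly
var i = (ℚ.1ℚ , Vec.tabulate (λ j → if does (i Fin.≟ j) then 1 else 0)) ∷ []

J s t x y p q : Poly
J = var (Fin.# 0)
s = var (Fin.# 1)
t = var (Fin.# 2)
x = var (Fin.# 3)
y = var (Fin.# 4)
p = var (Fin.# 5)
q = var (Fin.# 6)

record IsDerivation (D : Poly → Poly) : Set where
  field
    D-cong    : ∀ {P Q} → P ≈ Q → D P ≈ D Q
    D-+       : ∀ P Q → D (P ⊕ Q) ≈ D P ⊕ D Q
    D-scale   : ∀ c P → D (scale c P) ≈ scale c (D P)
    D-leibniz : ∀ P Q → D (P ⊗ Q) ≈ D P ⊗ Q ⊕ P ⊗ D Q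

iter : ℕ → (Poly → Poly) → Poly → Poly
iter zero    D P = P
iter (suc n) D P = D (iter n D P)

-- Signed permutations.  σ ∈ B_n is given by a permutation π of [n]
-- (π i = |σ(i)|, encoded as a vector, Fin n standing for {1..n})
-- together with a sign vector ε (ε i = true iff σ(i) < 0).

allVecs : {A : Set} → (k : ℕ) → List A → List (Vec A k)
allVecs zero    xs = [] ∷ []
allVecs (suc k) xs = concatMap (λ a → map (a ∷_) (allVecs k xs)) xs

anyB : {A : Set} → (A → Bool) → List A → Bool
anyB f []       = false
anyB f (a ∷ as) = if f a then true else anyB f as

allB : {A : Set} → (A → Bool) → List A → Bool
allB f as = not (anyB (λ a → not (f a)) as)

countB : {A : Set} → (A → Bool) → List A → ℕ
countB f []       = 0
countB f (a ∷ as) = if f a then suc (countB f as) else countB f as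

isPerm : ∀ {n} → Vec (Fin n) n → Bool
isPerm {n} π = allB (λ i → allB (λ j →
  not (does (lookup π i Fin.≟ lookup π j)) ∨' does (i Fin.≟ j)) (allFin n)) (allFin n)
  where
  _∨'_ : Bool → Bool → Bool
  true  ∨' _ = true
  false ∨' b = b

perms : (n : ℕ) → List (Vec (Fin n) n)
perms n = filter (λ π → isPerm π Data.Bool.≟ true) (allVecs n (allFin n))
  where import Data.Bool

signs : (n : ℕ) → List (Vec Bool n)
signs n = allVecs n (true ∷ false ∷ [])

signedPerms : (n : ℕ) → List (Vec (Fin n) n × Vec Bool n)
signedPerms n = concatMap (λ π → map (π ,_) (signs n)) (perms n)

module _ {n : ℕ} (π : Vec (Fin n) n) (ε : Vec Bool n) where

  -- σ(i) as an integer in ±[n]  (Fin index k stands for k+1)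
  σ : Fin n → ℤ
  σ i = if lookup ε i then -[1+ toℕ (lookup π i) ] else + suc (toℕ (lookup π i))

  σσ : Fin n → ℤ
  σσ i = σ (lookup π i)

  exc aexc fix st neg cyc : ℕ
  exc  = countB (λ i → does (σ i ℤ.<? σσ i)) (allFin n)
  aexc = countB (λ i → does (σσ i ℤ.<? σ i)) (allFin n)
  fix  = countB (λ i → does (σ i ℤ.≟ + suc (toℕ i))) (allFin n)
  st   = countB (λ i → does (σ i ℤ.≟ -[1+ toℕ i ])) (allFin n)
  neg  = countB (λ i → lookup ε i) (allFin n)

  πpow : ℕ → Fin n → Fin n
  πpow zero    i = i
  πpow (suc k) i = lookup π (πpow k i)

  -- number of cycles of i ↦ |σ(i)|: count the elements that are the
  -- minimum of their cycle (i ≤ π^k(i) for all k ≤ n; each cycle has length ≤ n)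
  cyc = countB (λ i → allB (λ k → does (toℕ i ℕ.≤? toℕ (πpow k i))) (List.upTo (suc n))) (allFin n)

  -- monomial  x^exc y^aexc s^fix t^st p^cyc q^N   (exponent of J is 0)
  weight : Mon
  weight = 0 ∷ fix ∷ st ∷ exc ∷ aexc ∷ cyc ∷ neg ∷ []

B : ℕ → Poly
B n = map (λ { (π , ε) → (ℚ.1ℚ , weight π ε) }) (signedPerms n)

-- Identify a monomial with its exponent vector, so that J · B_n is the multiset of the monomials
-- J x^exc y^aexc s^fix t^st p^cyc q^N over σ ∈ B_n.  By the Leibniz rule, D sends a monomial to the
-- multiset of monomials obtained by replacing one letter: J by pJs or pqJt, and any of s, t, x, y
-- by xy or xyq (p and q are constants).  These replacements match the ways of inserting n+1 into σ:
-- as a new fixed point or singleton (replacing J, since a cycle is created), or right after |σ(k)|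
-- in the cycle of k with either sign (replacing the letter that records the status of position k).
-- Insertion is a bijection from B_n × choices onto B_{n+1}, so D (J · B_n) = J · B_{n+1}, and the
-- theorem follows by induction on n.

module Submission where

open import Defs
open import Data.Bool using (Bool; true; false; if_then_else_; not; T)
import Data.Bool.Properties as Boolₚ
open import Data.Empty using (⊥; ⊥-elim)
open import Data.Fin as Fin using (Fin; zero; suc; inject₁; fromℕ; toℕ; _≟_)
import Data.Fin.Properties as Finₚ
open import Data.Fin.Relation.Unary.Top using (view; ‵fromℕ; ‵inject₁)
open import Data.Integer as ℤ using (ℤ; -[1+_])
import Data.Integer.Properties as ℤₚ
open import Data.List as List using (List; []; _∷_; _++_; map; concatMap; filter)
import Data.List.Properties as Listₚ
open import Data.Maybe as Maybe using (Maybe; just; nothing)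
import Data.Maybe.Properties as Maybeₚ
open import Data.Nat as ℕ using (ℕ; zero; suc; _+_; _*_; _∸_; _≤_; _<_)
open import Data.Nat.DivMod using (_%_; _/_; m≡m%n+[m/n]*n; m%n<n)
import Data.Nat.Properties as ℕₚ
open import Algebra.Properties.CommutativeMonoid.Sum ℕₚ.+-0-commutativeMonoid
  using (sum; sum-cong-≗; sum-init-last; sum-remove; sum-replicate-zero)
open import Data.Nat.Solver using (module +-*-Solver)
open import Data.Product using (_×_; _,_; proj₁; proj₂; ∃; uncurry)
import Data.Product.Properties as Productₚ
open import Data.Rational as ℚ using (ℚ; 0ℚ; 1ℚ)
import Data.Rational.Properties as ℚₚ
open import Data.Sum using (_⊎_; inj₁; inj₂)
open import Data.Vec as Vec using (Vec; []; _∷_; zipWith; lookup; tabulate)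
open import Data.Vec.Properties as Vecₚ using (≡-dec)
open import Function using (_∘_; _∘′_; id; flip)
open import Function.Definitions using (Injective)
open import Relation.Binary.Bundles using (Setoid)
open import Relation.Binary.Definitions using (DecidableEquality; tri<; tri≈; tri>)
open import Relation.Binary.PropositionalEquality hiding (J)
import Relation.Binary.Reasoning.Setoid
open import Relation.Nullary using (does; yes; no; Dec)
open import Relation.Nullary.Decidable using (dec-true; dec-false)
open +-*-Solver using (solve; _:+_; _:=_)

private variable
  n : ℕ
  A X Y : Set

⟦_⟧ : Bool → ℕ
⟦ true  ⟧ = 1
⟦ false ⟧ = 0

∑ : List A → (A → ℕ) → ℕ
∑ []      f = 0
∑ (a ∷ L) f = f a ℕ.+ ∑ L f

syntax ∑ L (λ a → e) = ∑[ a ∈ L ] e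

∑-cong : ∀ (L : List X) {f g : X → ℕ} → (∀ a → f a ≡ g a) → ∑ L f ≡ ∑ L g
∑-cong []      f≗g = refl
∑-cong (a ∷ L) f≗g = cong₂ _+_ (f≗g a) (∑-cong L f≗g)

∑-++ : ∀ (L M : List X) f → ∑ (L ++ M) f ≡ ∑ L f + ∑ M f
∑-++ []      M f = refl
∑-++ (a ∷ L) M f = trans (cong (f a +_) (∑-++ L M f)) (sym (ℕₚ.+-assoc (f a) _ _))

∑-zero : ∀ (L : List X) → ∑[ a ∈ L ] 0 ≡ 0
∑-zero []      = refl
∑-zero (a ∷ L) = ∑-zero L

∑-distrib-+ : ∀ (L : List X) f g → ∑[ a ∈ L ] (f a + g a) ≡ ∑ L f + ∑ L g
∑-distrib-+ []      f g = refl
∑-distrib-+ (a ∷ L) f g = trans (cong (f a + g a +_) (∑-distrib-+ L f g))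
  (solve 4 (λ w x y z → (w :+ x) :+ (y :+ z) := (w :+ y) :+ (x :+ z)) refl (f a) (g a) (∑ L f) (∑ L g))

∑-*ˡ : ∀ (L : List X) f c → ∑[ a ∈ L ] (c * f a) ≡ c * ∑ L f
∑-*ˡ []      f c = sym (ℕₚ.*-zeroʳ c)
∑-*ˡ (a ∷ L) f c = trans (cong (c * f a +_) (∑-*ˡ L f c)) (sym (ℕₚ.*-distribˡ-+ c (f a) _))

∑-*ʳ : ∀ (L : List X) f c → ∑[ a ∈ L ] (f a * c) ≡ ∑ L f * c
∑-*ʳ []      f c = refl
∑-*ʳ (a ∷ L) f c = trans (cong (f a * c +_) (∑-*ʳ L f c)) (sym (ℕₚ.*-distribʳ-+ c (f a) _))

∑-map : ∀ (g : X → Y) (L : List X) f → ∑ (map g L) f ≡ ∑[ a ∈ L ] f (g a)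
∑-map g []      f = refl
∑-map g (a ∷ L) f = cong (f (g a) +_) (∑-map g L f)

∑-concatMap : ∀ (g : X → List Y) (L : List X) f → ∑ (concatMap g L) f ≡ ∑[ a ∈ L ] ∑ (g a) f
∑-concatMap g []      f = refl
∑-concatMap g (a ∷ L) f = trans (∑-++ (g a) (concatMap g L) f) (cong (∑ (g a) f +_) (∑-concatMap g L f))

∑-comm : ∀ (L : List X) (M : List Y) (f : X → Y → ℕ) → ∑[ a ∈ L ] ∑[ b ∈ M ] f a b ≡ ∑[ b ∈ M ] ∑[ a ∈ L ] f a b
∑-comm []      M f = sym (∑-zero M)
∑-comm (a ∷ L) M f = trans (cong (∑ M (f a) +_) (∑-comm L M f)) (sym (∑-distrib-+ M (f a) _))

restrict : Bool → ℕ → ℕ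
restrict c v = if c then v else 0

restrict-∑ : ∀ c (L : List X) f → restrict c (∑ L f) ≡ ∑[ x ∈ L ] restrict c (f x)
restrict-∑ true  L f = refl
restrict-∑ false L f = sym (∑-zero L)

∑-filter : ∀ (P : X → Bool) (L : List X) f →
           ∑ (filter (λ a → P a Boolₚ.≟ true) L) f ≡ ∑[ a ∈ L ] restrict (P a) (f a)
∑-filter P []      f = refl
∑-filter P (a ∷ L) f with P a
... | true  = cong (f a +_) (∑-filter P L f)
... | false = ∑-filter P L f

countB≡∑ : ∀ (P : X → Bool) L → countB P L ≡ ∑[ x ∈ L ] ⟦ P x ⟧
countB≡∑ P []      = refl
countB≡∑ P (x ∷ L) with P x
... | true  = cong suc (countB≡∑ P L)
... | false = countB≡∑ P L

∑-tabulate : ∀ (g : Fin n → X) f → ∑ (List.tabulate g) f ≡ sum (λ i → f (g i))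
∑-tabulate {n = zero}  g f = refl
∑-tabulate {n = suc n} g f = cong (f (g zero) +_) (∑-tabulate (g ∘ suc) f)

countB-tabulate : ∀ (P : X → Bool) (f : Fin n → X) → countB P (List.tabulate f) ≡ sum (λ i → ⟦ P (f i) ⟧)
countB-tabulate P f = trans (countB≡∑ P (List.tabulate f)) (∑-tabulate f (λ x → ⟦ P x ⟧))

-- A record wrapper around _≈_, so that P and Q can be inferred from a proof of P ≋ Q.
infix 4 _≋_
record _≋_ (P Q : Poly) : Set where
  constructor ≈⇒≋
  field ≋⇒≈ : P ≈ Q
open _≋_ public

≋-setoid : Setoid _ _
≋-setoid = record
  { Carrier       = Poly
  ; _≈_           = _≋_
  ; isEquivalence = record
    { refl  = ≈⇒≋ λ _ → refl
    ; sym   = λ (≈⇒≋ e) → ≈⇒≋ λ m → sym (e m)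
    ; trans = λ (≈⇒≋ e) (≈⇒≋ f) → ≈⇒≋ λ m → trans (e m) (f m)
    }
  }

open Setoid ≋-setoid public using () renaming (refl to ≋-refl)
module ≋-Reasoning = Relation.Binary.Reasoning.Setoid ≋-setoid

coeff-++ : ∀ P Q m → coeff (P ++ Q) m ≡ coeff P m ℚ.+ coeff Q m
coeff-++ []            Q m = sym (ℚₚ.+-identityˡ _)
coeff-++ ((c , e) ∷ P) Q m with does (≡-dec ℕ._≟_ e m)
... | true  = trans (cong (c ℚ.+_) (coeff-++ P Q m)) (sym (ℚₚ.+-assoc c _ _))
... | false = coeff-++ P Q m

⊕-cong : ∀ {P P′ Q Q′} → P ≋ P′ → Q ≋ Q′ → P ⊕ Q ≋ P′ ⊕ Q′
⊕-cong {P} {P′} {Q} {Q′} (≈⇒≋ e) (≈⇒≋ f) = ≈⇒≋ λ m → begin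
  coeff (P ++ Q) m             ≡⟨ coeff-++ P Q m ⟩
  coeff P m ℚ.+ coeff Q m      ≡⟨ cong₂ ℚ._+_ (e m) (f m) ⟩
  coeff P′ m ℚ.+ coeff Q′ m    ≡⟨ coeff-++ P′ Q′ m ⟨
  coeff (P′ ++ Q′) m           ∎
  where open ≡-Reasoning

x≡x+x⇒x≡0 : ∀ (c : ℚ) → c ≡ c ℚ.+ c → c ≡ 0ℚ
x≡x+x⇒x≡0 c e = begin
  c                    ≡⟨ ℚₚ.+-identityʳ c ⟨
  c ℚ.+ 0ℚ             ≡⟨ cong (c ℚ.+_) (ℚₚ.+-inverseʳ c) ⟨
  c ℚ.+ (c ℚ.- c)      ≡⟨ ℚₚ.+-assoc c c (ℚ.- c) ⟨
  (c ℚ.+ c) ℚ.- c      ≡⟨ cong (ℚ._- c) e ⟨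
  c ℚ.- c              ≡⟨ ℚₚ.+-inverseʳ c ⟩
  0ℚ                   ∎
  where open ≡-Reasoning

P≋P⊕P⇒P≋0 : ∀ {P} → P ≋ P ⊕ P → P ≋ 0P
P≋P⊕P⇒P≋0 {P} (≈⇒≋ e) = ≈⇒≋ λ m → x≡x+x⇒x≡0 (coeff P m) (trans (e m) (coeff-++ P P m))

infixl 6 _+ᵐ_ _∸ᵐ_

_+ᵐ_ _∸ᵐ_ : ∀ {k} → Vec ℕ k → Vec ℕ k → Vec ℕ k
_+ᵐ_ = zipWith ℕ._+_
_∸ᵐ_ = zipWith ℕ._∸_

0ᵐ : Mon
0ᵐ = Vec.replicate 7 0

+ᵐ-comm : ∀ {k} (u w : Vec ℕ k) → u +ᵐ w ≡ w +ᵐ u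
+ᵐ-comm []      []      = refl
+ᵐ-comm (a ∷ u) (b ∷ w) = cong₂ _∷_ (ℕₚ.+-comm a b) (+ᵐ-comm u w)

+ᵐ-identityˡ : ∀ {k} (w : Vec ℕ k) → Vec.replicate k 0 +ᵐ w ≡ w
+ᵐ-identityˡ []      = refl
+ᵐ-identityˡ (a ∷ w) = cong (a ∷_) (+ᵐ-identityˡ w)

u+ᵐw∸ᵐu≡w : ∀ {k} (u w : Vec ℕ k) → u +ᵐ w ∸ᵐ u ≡ w
u+ᵐw∸ᵐu≡w []      []      = refl
u+ᵐw∸ᵐu≡w (a ∷ u) (b ∷ w) = cong₂ _∷_ (ℕₚ.m+n∸m≡n a b) (u+ᵐw∸ᵐu≡w u w)

+ᵐ-cancelˡ : ∀ {k} (u : Vec ℕ k) {w w′} → u +ᵐ w ≡ u +ᵐ w′ → w ≡ w′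
+ᵐ-cancelˡ u {w} {w′} e =
  trans (sym (u+ᵐw∸ᵐu≡w u w)) (trans (cong (_∸ᵐ u) e) (u+ᵐw∸ᵐu≡w u w′))

shift : Mon → Poly → Poly
shift u = map λ { (c , m) → (c , u +ᵐ m) }

coeff-shift : ∀ u P w → coeff (shift u P) (u +ᵐ w) ≡ coeff P w
coeff-shift u []            w = refl
coeff-shift u ((c , e) ∷ P) w with ≡-dec ℕ._≟_ (u +ᵐ e) (u +ᵐ w) | ≡-dec ℕ._≟_ e w
... | yes _  | yes _  = cong (c ℚ.+_) (coeff-shift u P w)
... | no  _  | no  _  = coeff-shift u P w
... | yes ue | no ¬e  = ⊥-elim (¬e (+ᵐ-cancelˡ u ue))
... | no ¬ue | yes e  = ⊥-elim (¬ue (cong (u +ᵐ_) e))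

coeff-shift-∉ : ∀ u P v → (∀ w → u +ᵐ w ≢ v) → coeff (shift u P) v ≡ 0ℚ
coeff-shift-∉ u []            v ∉ = refl
coeff-shift-∉ u ((c , e) ∷ P) v ∉ with ≡-dec ℕ._≟_ (u +ᵐ e) v
... | yes ue = ⊥-elim (∉ e ue)
... | no  _  = coeff-shift-∉ u P v ∉

shift-cong : ∀ u {P Q} → P ≋ Q → shift u P ≋ shift u Q
shift-cong u {P} {Q} (≈⇒≋ e) = ≈⇒≋ coeff-≡
  where
  coeff-≡ : ∀ v → coeff (shift u P) v ≡ coeff (shift u Q) v
  coeff-≡ v with ≡-dec ℕ._≟_ (u +ᵐ (v ∸ᵐ u)) v
  ... | yes v≡u+w = begin
    coeff (shift u P) v                ≡⟨ cong (coeff (shift u P)) v≡u+w ⟨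
    coeff (shift u P) (u +ᵐ (v ∸ᵐ u))  ≡⟨ coeff-shift u P _ ⟩
    coeff P (v ∸ᵐ u)                   ≡⟨ e _ ⟩
    coeff Q (v ∸ᵐ u)                   ≡⟨ coeff-shift u Q _ ⟨
    coeff (shift u Q) (u +ᵐ (v ∸ᵐ u))  ≡⟨ cong (coeff (shift u Q)) v≡u+w ⟩
    coeff (shift u Q) v                ∎
    where open ≡-Reasoning
  ... | no ¬v = trans (coeff-shift-∉ u P v ∉) (sym (coeff-shift-∉ u Q v ∉))
    where
    ∉ : ∀ w → u +ᵐ w ≢ v
    ∉ w refl = ¬v (cong (u +ᵐ_) (u+ᵐw∸ᵐu≡w u w))

shift-0ᵐ : ∀ P → shift 0ᵐ P ≡ P
shift-0ᵐ P = trans (Listₚ.map-cong (λ { (c , m) → cong (c ,_) (+ᵐ-identityˡ m) }) P) (Listₚ.map-id P)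

monomial : Mon → Poly
monomial m = (1ℚ , m) ∷ []

monomial-⊗ : ∀ u P → monomial u ⊗ P ≡ shift u P
monomial-⊗ u []            = refl
monomial-⊗ u ((c , m) ∷ P) =
  cong₂ _∷_ (cong (_, u +ᵐ m) (ℚₚ.*-identityˡ c)) (monomial-⊗ u P)

⊗-monomial : ∀ P u → P ⊗ monomial u ≡ shift u P
⊗-monomial []            u = refl
⊗-monomial ((c , m) ∷ P) u =
  cong₂ _∷_ (cong₂ _,_ (ℚₚ.*-identityʳ c) (+ᵐ-comm m u)) (⊗-monomial P u)

monomials : List Mon → Poly
monomials = map (1ℚ ,_)

monomials-++ : ∀ L M → monomials (L ++ M) ≡ monomials L ⊕ monomials M
monomials-++ L M = Listₚ.map-++ _ L M

shift-monomials : ∀ u L → shift u (monomials L) ≡ monomials (map (u +ᵐ_) L)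
shift-monomials u []      = refl
shift-monomials u (m ∷ L) = cong ((1ℚ , u +ᵐ m) ∷_) (shift-monomials u L)

multiplicity : List Mon → Mon → ℕ
multiplicity L v = ∑[ m ∈ L ] ⟦ does (≡-dec ℕ._≟_ m v) ⟧

monomials-cong : ∀ L M → (∀ v → multiplicity L v ≡ multiplicity M v) → monomials L ≋ monomials M
monomials-cong L M e = ≈⇒≋ λ v → trans (coeff-monomials L v) (trans (cong ofℕ (e v)) (sym (coeff-monomials M v)))
  where
  ofℕ : ℕ → ℚ
  ofℕ zero    = 0ℚ
  ofℕ (suc k) = 1ℚ ℚ.+ ofℕ k

  coeff-monomials : ∀ L v → coeff (monomials L) v ≡ ofℕ (multiplicity L v)
  coeff-monomials []      v = refl
  coeff-monomials (m ∷ L) v with does (≡-dec ℕ._≟_ m v)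
  ... | true  = cong (1ℚ ℚ.+_) (coeff-monomials L v)
  ... | false = coeff-monomials L v

-- The derivative of a monomial

Jᵐ sᵐ tᵐ xᵐ yᵐ pᵐ qᵐ : Mon
Jᵐ = 1 ∷ 0 ∷ 0 ∷ 0 ∷ 0 ∷ 0 ∷ 0 ∷ []
sᵐ = 0 ∷ 1 ∷ 0 ∷ 0 ∷ 0 ∷ 0 ∷ 0 ∷ []
tᵐ = 0 ∷ 0 ∷ 1 ∷ 0 ∷ 0 ∷ 0 ∷ 0 ∷ []
xᵐ = 0 ∷ 0 ∷ 0 ∷ 1 ∷ 0 ∷ 0 ∷ 0 ∷ []
yᵐ = 0 ∷ 0 ∷ 0 ∷ 0 ∷ 1 ∷ 0 ∷ 0 ∷ []
pᵐ = 0 ∷ 0 ∷ 0 ∷ 0 ∷ 0 ∷ 1 ∷ 0 ∷ []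
qᵐ = 0 ∷ 0 ∷ 0 ∷ 0 ∷ 0 ∷ 0 ∷ 1 ∷ []

∂J ∂stxy : List Mon
∂J = (1 ∷ 1 ∷ 0 ∷ 0 ∷ 0 ∷ 1 ∷ 0 ∷ []) ∷ (1 ∷ 0 ∷ 1 ∷ 0 ∷ 0 ∷ 1 ∷ 1 ∷ []) ∷ []
∂stxy = (0 ∷ 0 ∷ 0 ∷ 1 ∷ 1 ∷ 0 ∷ 0 ∷ []) ∷ (0 ∷ 0 ∷ 0 ∷ 1 ∷ 1 ∷ 0 ∷ 1 ∷ []) ∷ []

pJ[s+qt]≡∂J : p ⊗ J ⊗ (s ⊕ q ⊗ t) ≡ monomials ∂J
pJ[s+qt]≡∂J = refl

[1+q]xy≡∂stxy : (1P ⊕ q) ⊗ x ⊗ y ≡ monomials ∂stxy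
[1+q]xy≡∂stxy = refl

infixl 7 _⊗ᵐ_

_⊗ᵐ_ : List Mon → Mon → List Mon
G ⊗ᵐ u = map (_+ᵐ u) G

repeat : ℕ → List A → List A
repeat zero    L = []
repeat (suc k) L = L ++ repeat k L

map-repeat : (f : X → Y) (k : ℕ) (L : List X) → map f (repeat k L) ≡ repeat k (map f L)
map-repeat f zero    L = refl
map-repeat f (suc k) L = trans (Listₚ.map-++ f L (repeat k L)) (cong (map f L ++_) (map-repeat f k L))

repeat-pred : (k : ℕ) (F : ℕ → List A) → repeat k (F (suc (k ∸ 1))) ≡ repeat k (F k)
repeat-pred zero    F = refl
repeat-pred (suc k) F = refl

unfold : List (ℕ × List Mon) → List Mon
unfold []            = []
unfold ((k , L) ∷ B) = repeat k L ++ unfold B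

unfold-step : ∀ k (F : ℕ → List Mon) B →
  F k ++ unfold ((k , F (suc (k ∸ 1))) ∷ B) ≡ unfold ((suc k , F k) ∷ B)
unfold-step k F B = begin
  F k ++ (repeat k (F (suc (k ∸ 1))) ++ unfold B)  ≡⟨ cong (λ R → F k ++ (R ++ unfold B)) (repeat-pred k F) ⟩
  F k ++ (repeat k (F k) ++ unfold B)              ≡⟨ Listₚ.++-assoc (F k) (repeat k (F k)) (unfold B) ⟨
  repeat (suc k) (F k) ++ unfold B                 ∎
  where open ≡-Reasoning

mapBlocks : (Mon → Mon) → List (ℕ × List Mon) → List (ℕ × List Mon)
mapBlocks f = map λ { (k , L) → (k , map f L) }

map-unfold : ∀ (f : Mon → Mon) B → map f (unfold B) ≡ unfold (mapBlocks f B)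
map-unfold f []            = refl
map-unfold f ((k , L) ∷ B) = begin
  map f (repeat k L ++ unfold B)          ≡⟨ Listₚ.map-++ f (repeat k L) (unfold B) ⟩
  map f (repeat k L) ++ map f (unfold B)  ≡⟨ cong₂ _++_ (map-repeat f k L) (map-unfold f B) ⟩
  repeat k (map f L) ++ unfold (mapBlocks f B)  ∎
  where open ≡-Reasoning

-- m ↦ [(mᵢ , D(vᵢ) · m / vᵢ)]: the summands of D m by the Leibniz rule, using D p = D q = 0
-- and D s = D t = D x = D y.
∂-blocks : Mon → List (ℕ × List Mon)
∂-blocks (a ∷ b ∷ c ∷ d ∷ e ∷ f ∷ g ∷ []) =
  (a , ∂J ⊗ᵐ (a ∸ 1 ∷ b ∷ c ∷ d ∷ e ∷ f ∷ g ∷ [])) ∷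
  (b , ∂stxy ⊗ᵐ (a ∷ b ∸ 1 ∷ c ∷ d ∷ e ∷ f ∷ g ∷ [])) ∷
  (c , ∂stxy ⊗ᵐ (a ∷ b ∷ c ∸ 1 ∷ d ∷ e ∷ f ∷ g ∷ [])) ∷
  (d , ∂stxy ⊗ᵐ (a ∷ b ∷ c ∷ d ∸ 1 ∷ e ∷ f ∷ g ∷ [])) ∷
  (e , ∂stxy ⊗ᵐ (a ∷ b ∷ c ∷ d ∷ e ∸ 1 ∷ f ∷ g ∷ [])) ∷ []

∂ : Mon → List Mon
∂ m = unfold (∂-blocks m)

multiplicity-repeat : ∀ k L v → multiplicity (repeat k L) v ≡ k * multiplicity L v
multiplicity-repeat zero    L v = refl
multiplicity-repeat (suc k) L v = trans (∑-++ L (repeat k L) _) (cong (multiplicity L v +_) (multiplicity-repeat k L v))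

multiplicity-unfold : ∀ B v → multiplicity (unfold B) v ≡ ∑ B (λ { (k , L) → k * multiplicity L v })
multiplicity-unfold []            v = refl
multiplicity-unfold ((k , L) ∷ B) v =
  trans (∑-++ (repeat k L) (unfold B) _) (cong₂ _+_ (multiplicity-repeat k L v) (multiplicity-unfold B v))

-- The Leibniz rule for ∂, peeling off the first nonzero exponent: since the blocks before it are
-- empty, both sides agree as lists and not merely as multisets.
∂-sucJ : ∀ a b c d e f g → let m = a ∷ b ∷ c ∷ d ∷ e ∷ f ∷ g ∷ [] in
  ∂J ⊗ᵐ m ++ map (Jᵐ +ᵐ_) (∂ m) ≡ ∂ (suc a ∷ b ∷ c ∷ d ∷ e ∷ f ∷ g ∷ [])
∂-sucJ a b c d e f g =
  trans (cong (∂J ⊗ᵐ m ++_) (map-unfold (Jᵐ +ᵐ_) (∂-blocks m)))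
    (unfold-step a F (List.drop 1 (∂-blocks (suc a ∷ b ∷ c ∷ d ∷ e ∷ f ∷ g ∷ []))))
  where
  m = a ∷ b ∷ c ∷ d ∷ e ∷ f ∷ g ∷ []
  F : ℕ → List Mon
  F a′ = ∂J ⊗ᵐ (a′ ∷ b ∷ c ∷ d ∷ e ∷ f ∷ g ∷ [])

∂-sucs : ∀ b c d e f g → let m = 0 ∷ b ∷ c ∷ d ∷ e ∷ f ∷ g ∷ [] in
  ∂stxy ⊗ᵐ m ++ map (sᵐ +ᵐ_) (∂ m) ≡ ∂ (0 ∷ suc b ∷ c ∷ d ∷ e ∷ f ∷ g ∷ [])
∂-sucs b c d e f g =
  trans (cong (∂stxy ⊗ᵐ m ++_) (map-unfold (sᵐ +ᵐ_) (∂-blocks m)))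
    (unfold-step b F (List.drop 2 (∂-blocks (0 ∷ suc b ∷ c ∷ d ∷ e ∷ f ∷ g ∷ []))))
  where
  m = 0 ∷ b ∷ c ∷ d ∷ e ∷ f ∷ g ∷ []
  F : ℕ → List Mon
  F b′ = ∂stxy ⊗ᵐ (0 ∷ b′ ∷ c ∷ d ∷ e ∷ f ∷ g ∷ [])

∂-suct : ∀ c d e f g → let m = 0 ∷ 0 ∷ c ∷ d ∷ e ∷ f ∷ g ∷ [] in
  ∂stxy ⊗ᵐ m ++ map (tᵐ +ᵐ_) (∂ m) ≡ ∂ (0 ∷ 0 ∷ suc c ∷ d ∷ e ∷ f ∷ g ∷ [])
∂-suct c d e f g =
  trans (cong (∂stxy ⊗ᵐ m ++_) (map-unfold (tᵐ +ᵐ_) (∂-blocks m)))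
    (unfold-step c F (List.drop 3 (∂-blocks (0 ∷ 0 ∷ suc c ∷ d ∷ e ∷ f ∷ g ∷ []))))
  where
  m = 0 ∷ 0 ∷ c ∷ d ∷ e ∷ f ∷ g ∷ []
  F : ℕ → List Mon
  F c′ = ∂stxy ⊗ᵐ (0 ∷ 0 ∷ c′ ∷ d ∷ e ∷ f ∷ g ∷ [])

∂-sucx : ∀ d e f g → let m = 0 ∷ 0 ∷ 0 ∷ d ∷ e ∷ f ∷ g ∷ [] in
  ∂stxy ⊗ᵐ m ++ map (xᵐ +ᵐ_) (∂ m) ≡ ∂ (0 ∷ 0 ∷ 0 ∷ suc d ∷ e ∷ f ∷ g ∷ [])
∂-sucx d e f g =
  trans (cong (∂stxy ⊗ᵐ m ++_) (map-unfold (xᵐ +ᵐ_) (∂-blocks m)))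
    (unfold-step d F (List.drop 4 (∂-blocks (0 ∷ 0 ∷ 0 ∷ suc d ∷ e ∷ f ∷ g ∷ []))))
  where
  m = 0 ∷ 0 ∷ 0 ∷ d ∷ e ∷ f ∷ g ∷ []
  F : ℕ → List Mon
  F d′ = ∂stxy ⊗ᵐ (0 ∷ 0 ∷ 0 ∷ d′ ∷ e ∷ f ∷ g ∷ [])

∂-sucy : ∀ e f g → let m = 0 ∷ 0 ∷ 0 ∷ 0 ∷ e ∷ f ∷ g ∷ [] in
  ∂stxy ⊗ᵐ m ++ map (yᵐ +ᵐ_) (∂ m) ≡ ∂ (0 ∷ 0 ∷ 0 ∷ 0 ∷ suc e ∷ f ∷ g ∷ [])
∂-sucy e f g =
  trans (cong (∂stxy ⊗ᵐ m ++_) (map-unfold (yᵐ +ᵐ_) (∂-blocks m)))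
    (unfold-step e F [])
  where
  m = 0 ∷ 0 ∷ 0 ∷ 0 ∷ e ∷ f ∷ g ∷ []
  F : ℕ → List Mon
  F e′ = ∂stxy ⊗ᵐ (0 ∷ 0 ∷ 0 ∷ 0 ∷ e′ ∷ f ∷ g ∷ [])

module _ (D : Poly → Poly) (isD : IsDerivation D) where
  open IsDerivation isD
  open ≋-Reasoning

  D-0P : D 0P ≋ 0P
  D-0P = P≋P⊕P⇒P≋0 (≈⇒≋ (D-+ 0P 0P))

  D-1P : D 1P ≋ 0P
  D-1P = P≋P⊕P⇒P≋0 (begin
    D 1P                                      ≈⟨ ≈⇒≋ (D-leibniz 1P 1P) ⟩
    D 1P ⊗ monomial 0ᵐ ⊕ monomial 0ᵐ ⊗ D 1P   ≡⟨ cong₂ _⊕_ (⊗-monomial (D 1P) 0ᵐ) (monomial-⊗ 0ᵐ (D 1P)) ⟩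
    shift 0ᵐ (D 1P) ⊕ shift 0ᵐ (D 1P)         ≡⟨ cong₂ _⊕_ (shift-0ᵐ (D 1P)) (shift-0ᵐ (D 1P)) ⟩
    D 1P ⊕ D 1P                               ∎)

  D-monomial-+ᵐ : ∀ u G m E {F} → G ⊗ᵐ m ++ map (u +ᵐ_) E ≡ F →
    D (monomial u) ≋ monomials G → D (monomial m) ≋ monomials E → D (monomial (u +ᵐ m)) ≋ monomials F
  D-monomial-+ᵐ u G m E refl DG DE = begin
    D (monomial u ⊗ monomial m)                               ≈⟨ ≈⇒≋ (D-leibniz (monomial u) (monomial m)) ⟩
    D (monomial u) ⊗ monomial m ⊕ monomial u ⊗ D (monomial m)
      ≡⟨ cong₂ _⊕_ (⊗-monomial (D (monomial u)) m) (monomial-⊗ u (D (monomial m))) ⟩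
    shift m (D (monomial u)) ⊕ shift u (D (monomial m))       ≈⟨ ⊕-cong (shift-cong m DG) (shift-cong u DE) ⟩
    shift m (monomials G) ⊕ shift u (monomials E)
      ≡⟨ cong₂ _⊕_ (trans (shift-monomials m G) (cong monomials (Listₚ.map-cong (+ᵐ-comm m) G))) (shift-monomials u E) ⟩
    monomials (G ⊗ᵐ m) ⊕ monomials (map (u +ᵐ_) E)            ≡⟨ monomials-++ (G ⊗ᵐ m) (map (u +ᵐ_) E) ⟨
    monomials (G ⊗ᵐ m ++ map (u +ᵐ_) E)                       ∎

  module _ (Dp : D p ≋ 0P) (Dq : D q ≋ 0P) (DJ : D J ≋ monomials ∂J)
           (Ds : D s ≋ monomials ∂stxy) (Dt : D t ≋ monomials ∂stxy)
           (Dx : D x ≋ monomials ∂stxy) (Dy : D y ≋ monomials ∂stxy) where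

    D-monomial : ∀ m → D (monomial m) ≋ monomials (∂ m)
    D-monomial (suc a ∷ b ∷ c ∷ d ∷ e ∷ f ∷ g ∷ []) =
      D-monomial-+ᵐ Jᵐ ∂J _ _ (∂-sucJ a b c d e f g) DJ (D-monomial _)
    D-monomial (0 ∷ suc b ∷ c ∷ d ∷ e ∷ f ∷ g ∷ []) =
      D-monomial-+ᵐ sᵐ ∂stxy _ _ (∂-sucs b c d e f g) Ds (D-monomial _)
    D-monomial (0 ∷ 0 ∷ suc c ∷ d ∷ e ∷ f ∷ g ∷ []) =
      D-monomial-+ᵐ tᵐ ∂stxy _ _ (∂-suct c d e f g) Dt (D-monomial _)
    D-monomial (0 ∷ 0 ∷ 0 ∷ suc d ∷ e ∷ f ∷ g ∷ []) =
      D-monomial-+ᵐ xᵐ ∂stxy _ _ (∂-sucx d e f g) Dx (D-monomial _)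
    D-monomial (0 ∷ 0 ∷ 0 ∷ 0 ∷ suc e ∷ f ∷ g ∷ []) =
      D-monomial-+ᵐ yᵐ ∂stxy _ _ (∂-sucy e f g) Dy (D-monomial _)
    D-monomial (0 ∷ 0 ∷ 0 ∷ 0 ∷ 0 ∷ suc f ∷ g ∷ []) = D-monomial-+ᵐ pᵐ [] _ _ refl Dp (D-monomial _)
    D-monomial (0 ∷ 0 ∷ 0 ∷ 0 ∷ 0 ∷ 0 ∷ suc g ∷ []) = D-monomial-+ᵐ qᵐ [] _ _ refl Dq (D-monomial _)
    D-monomial (0 ∷ 0 ∷ 0 ∷ 0 ∷ 0 ∷ 0 ∷ 0 ∷ [])     = D-1P

    D-monomials : ∀ L → D (monomials L) ≋ monomials (concatMap ∂ L)
    D-monomials []      = D-0P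
    D-monomials (m ∷ L) = begin
      D (monomial m ⊕ monomials L)                ≈⟨ ≈⇒≋ (D-+ (monomial m) (monomials L)) ⟩
      D (monomial m) ⊕ D (monomials L)            ≈⟨ ⊕-cong (D-monomial m) (D-monomials L) ⟩
      monomials (∂ m) ⊕ monomials (concatMap ∂ L) ≡⟨ monomials-++ (∂ m) (concatMap ∂ L) ⟨
      monomials (concatMap ∂ (m ∷ L))             ∎

infix 4 _≡ᵇ_

_≡ᵇ_ : Fin n → Fin n → Bool
i ≡ᵇ j = does (i ≟ j)

≡ᵇ-refl : (i : Fin n) → (i ≡ᵇ i) ≡ true
≡ᵇ-refl i = dec-true (i ≟ i) refl

≢⇒≡ᵇ-false : {i j : Fin n} → i ≢ j → (i ≡ᵇ j) ≡ false
≢⇒≡ᵇ-false {i = i} {j} = dec-false (i ≟ j)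

≡ᵇ-true⇒≡ : {i j : Fin n} → (i ≡ᵇ j) ≡ true → i ≡ j
≡ᵇ-true⇒≡ {i = i} {j} e with i ≟ j
... | yes i≡j = i≡j

≡ᵇ-false⇒≢ : {i j : Fin n} → (i ≡ᵇ j) ≡ false → i ≢ j
≡ᵇ-false⇒≢ {i = i} e refl with () ← trans (sym e) (≡ᵇ-refl i)

if-true : ∀ {c} (a b : A) → c ≡ true → (if c then a else b) ≡ a
if-true a b refl = refl

if-false : ∀ {c} (a b : A) → c ≡ false → (if c then a else b) ≡ b
if-false a b refl = refl

find : (Fin n → Bool) → Maybe (Fin n)
find {zero}  P = nothing
find {suc n} P = if P zero then just zero else Maybe.map suc (find (P ∘ suc))

find-just : ∀ (P : Fin n → Bool) {i} → find P ≡ just i → P i ≡ true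
find-just {suc n} P e with P zero in P0
find-just {suc n} P refl | true = P0
... | false with find (P ∘ suc) in found
find-just {suc n} P refl | false | just j = find-just (P ∘ suc) found

find-nothing : ∀ (P : Fin n → Bool) → find P ≡ nothing → ∀ i → P i ≡ false
find-nothing {suc n} P e i with P zero in P0
find-nothing {suc n} P () i | true
... | false with find (P ∘ suc) in found
find-nothing {suc n} P refl zero    | false | nothing = P0
find-nothing {suc n} P refl (suc i) | false | nothing = find-nothing (P ∘ suc) found i

find-unique : ∀ (P : Fin n → Bool) i → P i ≡ true → (∀ j → P j ≡ true → j ≡ i) → find P ≡ just i
find-unique P i Pi unique with find P in found
... | just j  = cong just (unique j (find-just P found))
... | nothing with () ← trans (sym (find-nothing P found i)) Pi

find-cong : ∀ (P Q : Fin n → Bool) → (∀ i → P i ≡ Q i) → find P ≡ find Q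
find-cong {zero}  P Q P≗Q = refl
find-cong {suc n} P Q P≗Q rewrite P≗Q zero | find-cong (P ∘ suc) (Q ∘ suc) (P≗Q ∘ suc) = refl

anyB-tabulate-false⁻ : ∀ (P : A → Bool) (f : Fin n → A) → anyB P (List.tabulate f) ≡ false → ∀ i → P (f i) ≡ false
anyB-tabulate-false⁻ {n = suc n} P f e i with P (f zero) in P0
anyB-tabulate-false⁻ {n = suc n} P f () i       | true
anyB-tabulate-false⁻ {n = suc n} P f e zero    | false = P0
anyB-tabulate-false⁻ {n = suc n} P f e (suc i) | false = anyB-tabulate-false⁻ P (f ∘ suc) e i

anyB-tabulate-true : ∀ (P : A → Bool) (f : Fin n → A) → anyB P (List.tabulate f) ≡ true → ∃ λ i → P (f i) ≡ true
anyB-tabulate-true {n = suc n} P f e with P (f zero) in P0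
... | true  = zero , P0
... | false with i , Pi ← anyB-tabulate-true P (f ∘ suc) e = suc i , Pi

not-≡-true : ∀ {b} → not b ≡ true → b ≡ false
not-≡-true {false} _ = refl

not-≡-false : ∀ {b} → not b ≡ false → b ≡ true
not-≡-false {true} _ = refl

allB-tabulate⁻ : ∀ (P : A → Bool) (f : Fin n → A) → allB P (List.tabulate f) ≡ true → ∀ i → P (f i) ≡ true
allB-tabulate⁻ P f e i = not-≡-false (anyB-tabulate-false⁻ (not ∘ P) f (not-≡-true e) i)

allB-tabulate-false : ∀ (P : A → Bool) (f : Fin n → A) → allB P (List.tabulate f) ≡ false → ∃ λ i → P (f i) ≡ false
allB-tabulate-false P f e with i , Pi ← anyB-tabulate-true (not ∘ P) f (not-≡-false e) = i , not-≡-true Pi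

allB-applyUpTo : ∀ (P : A → Bool) (f : ℕ → A) m → (∀ k → k ℕ.< m → P (f k) ≡ true) → allB P (List.applyUpTo f m) ≡ true
allB-applyUpTo P f zero    all = refl
allB-applyUpTo P f (suc m) all rewrite all 0 (ℕ.s≤s ℕ.z≤n) =
  allB-applyUpTo P (f ∘ suc) m (λ k k<m → all (suc k) (ℕ.s≤s k<m))

allB-applyUpTo⁻ : ∀ (P : A → Bool) (f : ℕ → A) m → allB P (List.applyUpTo f m) ≡ true → ∀ k → k ℕ.< m → P (f k) ≡ true
allB-applyUpTo⁻ P f (suc m) e k k<m with P (f 0) in P0
allB-applyUpTo⁻ P f (suc m) e zero    k<m          | true = P0
allB-applyUpTo⁻ P f (suc m) e (suc k) (ℕ.s≤s k<m) | true = allB-applyUpTo⁻ P (f ∘ suc) m e k k<m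

isPerm⇒injective : (π : Vec (Fin n) n) → isPerm π ≡ true → Injective _≡_ _≡_ (lookup π)
isPerm⇒injective π h {i} {j} e
  with lookup π i ≟ lookup π j | i ≟ j | allB-tabulate⁻ _ id (allB-tabulate⁻ _ id h i) j
... | _        | yes i≡j | _  = i≡j
... | yes _    | no _    | ()
... | no πi≢πj | no _    | _  = ⊥-elim (πi≢πj e)

injective⇒isPerm : (π : Vec (Fin n) n) → Injective _≡_ _≡_ (lookup π) → isPerm π ≡ true
injective⇒isPerm π inj with isPerm π in e
... | true = refl
... | false with allB-tabulate-false _ id e
... | i , ei with allB-tabulate-false _ id ei
... | j , eij with lookup π i ≟ lookup π j | i ≟ j | eij
... | yes _     | yes _   | ()
... | no _      | _       | ()
... | yes πi≡πj | no i≢j  | _ = ⊥-elim (i≢j (inj πi≡πj))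

injective⇒surjective : (f : Fin n → Fin n) → Injective _≡_ _≡_ f → ∀ y → ∃ λ x → f x ≡ y
injective⇒surjective {n} f inj y with find (λ x → f x ≡ᵇ y) in found
... | just x  = x , ≡ᵇ-true⇒≡ (find-just (λ x → f x ≡ᵇ y) found)
... | nothing = ⊥-elim (missing n f inj y (λ x → ≡ᵇ-false⇒≢ (find-nothing (λ x → f x ≡ᵇ y) found x)))
  where
  -- An injection Fin (suc m) → Fin (suc m) missing y would inject into Fin m via punchOut.
  missing : ∀ n (f : Fin n → Fin n) → Injective _≡_ _≡_ f → (y : Fin n) → (∀ x → f x ≢ y) → ⊥
  missing (suc m) f inj y ∉ with a , b , a<b , eq ← Finₚ.pigeonhole (ℕₚ.n<1+n m) (λ x → Fin.punchOut (∉ x ∘ sym))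
    = Finₚ.<⇒≢ a<b (inj (Finₚ.punchOut-injective (∉ a ∘ sym) (∉ b ∘ sym) eq))

extend : (Fin n → A) → A → Fin (suc n) → A
extend {zero}  f a zero    = a
extend {suc n} f a zero    = f zero
extend {suc n} f a (suc i) = extend (f ∘ suc) a i

extend-inject₁ : ∀ (f : Fin n → A) a i → extend f a (inject₁ i) ≡ f i
extend-inject₁ {suc n} f a zero    = refl
extend-inject₁ {suc n} f a (suc i) = extend-inject₁ (f ∘ suc) a i

extend-fromℕ : ∀ (f : Fin n → A) a → extend f a (fromℕ n) ≡ a
extend-fromℕ {zero}  f a = refl
extend-fromℕ {suc n} f a = extend-fromℕ (f ∘ suc) a

-- d is a junk value, returned for fromℕ n.
lower : Fin n → Fin (suc n) → Fin n
lower d = extend id d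

lower-inject₁ : ∀ (d i : Fin n) → lower d (inject₁ i) ≡ i
lower-inject₁ d = extend-inject₁ id d

inject₁-lower : ∀ (d : Fin n) x → x ≢ fromℕ n → inject₁ (lower d x) ≡ x
inject₁-lower d x x≢top with view x
... | ‵fromℕ     = ⊥-elim (x≢top refl)
... | ‵inject₁ i = cong inject₁ (lower-inject₁ d i)

inject₁≢fromℕ : (i : Fin n) → inject₁ i ≢ fromℕ n
inject₁≢fromℕ i = Finₚ.fromℕ≢inject₁ ∘ sym

vec-ext : (u v : Vec A n) → (∀ i → lookup u i ≡ lookup v i) → u ≡ v
vec-ext u v u≗v = trans (sym (Vecₚ.tabulate∘lookup u)) (trans (Vecₚ.tabulate-cong u≗v) (Vecₚ.tabulate∘lookup v))

lookup-extend-inject₁ : ∀ (f : Fin n → A) a i → lookup (tabulate (extend f a)) (inject₁ i) ≡ f i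
lookup-extend-inject₁ f a i = trans (Vecₚ.lookup∘tabulate (extend f a) (inject₁ i)) (extend-inject₁ f a i)

lookup-extend-fromℕ : ∀ (f : Fin n → A) a → lookup (tabulate (extend f a)) (fromℕ n) ≡ a
lookup-extend-fromℕ {n} f a = trans (Vecₚ.lookup∘tabulate (extend f a) (fromℕ n)) (extend-fromℕ f a)

tabulate-extend : ∀ (v : Vec A (suc n)) f a → (∀ i → f i ≡ lookup v (inject₁ i)) → a ≡ lookup v (fromℕ n) →
                  tabulate (extend f a) ≡ v
tabulate-extend v f a v-inject₁ v-top = vec-ext _ v λ x → trans (Vecₚ.lookup∘tabulate (extend f a) x) (same x)
  where
  same : ∀ x → extend f a x ≡ lookup v x
  same x with view x
  ... | ‵fromℕ     = trans (extend-fromℕ f a) v-top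
  ... | ‵inject₁ i = trans (extend-inject₁ f a i) (v-inject₁ i)

tabulate-injective : (f : Fin n → Fin n) → Injective _≡_ _≡_ f → Injective _≡_ _≡_ (lookup (tabulate f))
tabulate-injective f inj {a} {b} e = inj (trans (sym (Vecₚ.lookup∘tabulate f a)) (trans e (Vecₚ.lookup∘tabulate f b)))

-- Inserting and removing n+1

SignedPerm : ℕ → Set
SignedPerm n = Vec (Fin n) n × Vec Bool n

-- (nothing , b): n+1 becomes a fixed point (b = false) or a singleton (b = true).
-- (just k , b): n+1 is inserted into the cycle of k right after j = |σ(k)|; the arrow
-- j → n+1 gets sign b and the arrow n+1 → |σ(j)| inherits the old sign of j.
Choice : ℕ → Set
Choice n = Maybe (Fin n) × Bool

redirect : Vec (Fin n) n → Fin n → Fin n → Fin (suc n)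
redirect {n} π j i = if i ≡ᵇ j then fromℕ n else inject₁ (lookup π i)

resign : Vec Bool n → Fin n → Bool → Fin n → Bool
resign ε j b i = if i ≡ᵇ j then b else lookup ε i

insertPerm : Vec (Fin n) n → Maybe (Fin n) → Fin (suc n) → Fin (suc n)
insertPerm {n} π nothing  = extend (inject₁ ∘ lookup π) (fromℕ n)
insertPerm {n} π (just k) = extend (redirect π (lookup π k)) (inject₁ (lookup π (lookup π k)))

insertSigns : Vec (Fin n) n → Vec Bool n → Maybe (Fin n) → Bool → Fin (suc n) → Bool
insertSigns π ε nothing  b = extend (lookup ε) b
insertSigns π ε (just k) b = extend (resign ε (lookup π k) b) (lookup ε (lookup π k))

insert : SignedPerm n × Choice n → SignedPerm (suc n)
insert ((π , ε) , (c , b)) = tabulate (insertPerm π c) , tabulate (insertSigns π ε c b)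

module _ (π : Vec (Fin n) n) where

  insertPerm-nothing-inject₁ : ∀ i → lookup (tabulate (insertPerm π nothing)) (inject₁ i) ≡ inject₁ (lookup π i)
  insertPerm-nothing-inject₁ = lookup-extend-inject₁ _ _

  insertPerm-nothing-fromℕ : lookup (tabulate (insertPerm π nothing)) (fromℕ n) ≡ fromℕ n
  insertPerm-nothing-fromℕ = lookup-extend-fromℕ (inject₁ ∘ lookup π) _

  insertPerm-just-inject₁ : ∀ k i → lookup (tabulate (insertPerm π (just k))) (inject₁ i) ≡
                                    (if i ≡ᵇ lookup π k then fromℕ n else inject₁ (lookup π i))
  insertPerm-just-inject₁ k = lookup-extend-inject₁ _ _

  insertPerm-just-fromℕ : ∀ k → lookup (tabulate (insertPerm π (just k))) (fromℕ n) ≡ inject₁ (lookup π (lookup π k))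
  insertPerm-just-fromℕ k = lookup-extend-fromℕ (redirect π (lookup π k)) _

  module _ (ε : Vec Bool n) where

    insertSigns-nothing-inject₁ : ∀ b i → lookup (tabulate (insertSigns π ε nothing b)) (inject₁ i) ≡ lookup ε i
    insertSigns-nothing-inject₁ b = lookup-extend-inject₁ _ _

    insertSigns-nothing-fromℕ : ∀ b → lookup (tabulate (insertSigns π ε nothing b)) (fromℕ n) ≡ b
    insertSigns-nothing-fromℕ b = lookup-extend-fromℕ (lookup ε) _

    insertSigns-just-inject₁ : ∀ k b i → lookup (tabulate (insertSigns π ε (just k) b)) (inject₁ i) ≡
                                         (if i ≡ᵇ lookup π k then b else lookup ε i)
    insertSigns-just-inject₁ k b = lookup-extend-inject₁ _ _

    insertSigns-just-fromℕ : ∀ k b → lookup (tabulate (insertSigns π ε (just k) b)) (fromℕ n) ≡ lookup ε (lookup π k)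
    insertSigns-just-fromℕ k b = lookup-extend-fromℕ (resign ε (lookup π k) b) _

extend-injective : ∀ (g : Fin n → Fin (suc n)) a → Injective _≡_ _≡_ g → (∀ i → g i ≢ a) →
                   Injective _≡_ _≡_ (extend g a)
extend-injective g a inj a∉g {x} {y} e with view x | view y
... | ‵fromℕ     | ‵fromℕ     = refl
... | ‵inject₁ i | ‵inject₁ i′ =
  cong inject₁ (inj (trans (sym (extend-inject₁ g a i)) (trans e (extend-inject₁ g a i′))))
... | ‵inject₁ i | ‵fromℕ     = ⊥-elim (a∉g i (trans (sym (extend-inject₁ g a i)) (trans e (extend-fromℕ g a))))
... | ‵fromℕ     | ‵inject₁ i = ⊥-elim (a∉g i (trans (sym (extend-inject₁ g a i)) (trans (sym e) (extend-fromℕ g a))))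

insertPerm-injective : ∀ (π : Vec (Fin n) n) c → Injective _≡_ _≡_ (lookup π) → Injective _≡_ _≡_ (insertPerm π c)
insertPerm-injective {n} π nothing inj =
  extend-injective _ _ (inj ∘ Finₚ.inject₁-injective) (inject₁≢fromℕ ∘ lookup π)
insertPerm-injective {n} π (just k) inj = extend-injective g _ g-injective a∉g
  where
  j = lookup π k
  g = redirect π j

  g-injective : Injective _≡_ _≡_ g
  g-injective {i} {i′} e with i ≡ᵇ j in ij | i′ ≡ᵇ j in i′j
  ... | true  | true  = trans (≡ᵇ-true⇒≡ ij) (sym (≡ᵇ-true⇒≡ i′j))
  ... | false | false = inj (Finₚ.inject₁-injective e)
  ... | true  | false = ⊥-elim (inject₁≢fromℕ _ (sym e))
  ... | false | true  = ⊥-elim (inject₁≢fromℕ _ e)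

  a∉g : ∀ i → g i ≢ inject₁ (lookup π j)
  a∉g i e with i ≡ᵇ j in ij
  ... | true  = inject₁≢fromℕ _ (sym e)
  ... | false = ≡ᵇ-false⇒≢ ij (inj (Finₚ.inject₁-injective e))

matches : Maybe (Fin n) → Fin n → Bool
matches nothing  i = false
matches (just j) i = i ≡ᵇ j

predecessorOfTop : Vec (Fin (suc n)) (suc n) → Maybe (Fin n)
predecessorOfTop {n} τ = find (λ i → lookup τ (inject₁ i) ≡ᵇ fromℕ n)

removePerm : Vec (Fin (suc n)) (suc n) → Fin n → Fin n
removePerm {n} τ i =
  if matches (predecessorOfTop τ) i then lower i (lookup τ (fromℕ n)) else lower i (lookup τ (inject₁ i))

removeSigns : Vec (Fin (suc n)) (suc n) → Vec Bool (suc n) → Fin n → Bool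
removeSigns {n} τ ε i = if matches (predecessorOfTop τ) i then lookup ε (fromℕ n) else lookup ε (inject₁ i)

removedSign : Vec Bool (suc n) → Maybe (Fin n) → Bool
removedSign ε nothing  = false
removedSign ε (just j) = lookup ε (inject₁ j)

removeCase : Vec (Fin (suc n)) (suc n) → Vec Bool (suc n) → Bool → SignedPerm n × Choice n
removeCase {n} τ ε true  =
  (tabulate (λ i → lower i (lookup τ (inject₁ i))) , tabulate (lookup ε ∘ inject₁)) , (nothing , lookup ε (fromℕ n))
removeCase {n} τ ε false =
  (tabulate (removePerm τ) , tabulate (removeSigns τ ε)) ,
  (find (matches (predecessorOfTop τ) ∘ removePerm τ) , removedSign ε (predecessorOfTop τ))

remove : SignedPerm (suc n) → SignedPerm n × Choice n
remove {n} (τ , ε) = removeCase τ ε (lookup τ (fromℕ n) ≡ᵇ fromℕ n)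

remove-insert-nothing : ∀ (π : Vec (Fin n) n) ε b → remove (insert ((π , ε) , (nothing , b))) ≡ ((π , ε) , (nothing , b))
remove-insert-nothing {n} π ε b
  rewrite insertPerm-nothing-fromℕ π | ≡ᵇ-refl (fromℕ n) | insertSigns-nothing-fromℕ π ε b =
  cong₂ (λ π′ ε′ → (π′ , ε′) , (nothing , b))
    (vec-ext _ π (λ i → trans (Vecₚ.lookup∘tabulate _ i)
                         (trans (cong (lower i) (insertPerm-nothing-inject₁ π i)) (lower-inject₁ i (lookup π i)))))
    (vec-ext _ ε (λ i → trans (Vecₚ.lookup∘tabulate _ i) (insertSigns-nothing-inject₁ π ε b i)))

module RemoveInsertJust (π : Vec (Fin n) n) (ε : Vec Bool n) (k : Fin n) (b : Bool)
                        (inj : Injective _≡_ _≡_ (lookup π)) where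
  j = lookup π k
  τ = tabulate (insertPerm π (just k))
  ε⁺ = tabulate (insertSigns π ε (just k) b)

  predecessorOfTop≡j : predecessorOfTop τ ≡ just j
  predecessorOfTop≡j = find-unique _ j
    (trans (cong (_≡ᵇ fromℕ n) (trans (insertPerm-just-inject₁ π k j) (if-true _ _ (≡ᵇ-refl j)))) (≡ᵇ-refl (fromℕ n)))
    unique
    where
    unique : ∀ i → (lookup τ (inject₁ i) ≡ᵇ fromℕ n) ≡ true → i ≡ j
    unique i e with i ≡ᵇ j in ij
    ... | true  = ≡ᵇ-true⇒≡ ij
    ... | false = ⊥-elim (inject₁≢fromℕ (lookup π i)
                    (trans (sym (trans (insertPerm-just-inject₁ π k i) (if-false _ _ ij))) (≡ᵇ-true⇒≡ e)))

  removePerm≡π : ∀ i → lookup (tabulate (removePerm τ)) i ≡ lookup π i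
  removePerm≡π i rewrite Vecₚ.lookup∘tabulate (removePerm τ) i | predecessorOfTop≡j with i ≡ᵇ j in ij
  ... | true  = trans (cong (lower i) (insertPerm-just-fromℕ π k))
                  (trans (lower-inject₁ i _) (cong (lookup π) (sym (≡ᵇ-true⇒≡ ij))))
  ... | false = trans (cong (lower i) (trans (insertPerm-just-inject₁ π k i) (if-false _ _ ij))) (lower-inject₁ i _)

  removeSigns≡ε : ∀ i → lookup (tabulate (removeSigns τ ε⁺)) i ≡ lookup ε i
  removeSigns≡ε i rewrite Vecₚ.lookup∘tabulate (removeSigns τ ε⁺) i | predecessorOfTop≡j with i ≡ᵇ j in ij
  ... | true  = trans (insertSigns-just-fromℕ π ε k b) (cong (lookup ε) (sym (≡ᵇ-true⇒≡ ij)))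
  ... | false = trans (insertSigns-just-inject₁ π ε k b i) (if-false _ _ ij)

  find≡k : find (matches (predecessorOfTop τ) ∘ removePerm τ) ≡ just k
  find≡k = trans (find-cong _ (λ i → lookup π i ≡ᵇ j) same) (find-unique _ k (≡ᵇ-refl j) (λ i e → inj (≡ᵇ-true⇒≡ e)))
    where
    same : ∀ i → matches (predecessorOfTop τ) (removePerm τ i) ≡ (lookup π i ≡ᵇ j)
    same i = trans (cong (λ c → matches c (removePerm τ i)) predecessorOfTop≡j)
                   (cong (_≡ᵇ j) (trans (sym (Vecₚ.lookup∘tabulate (removePerm τ) i)) (removePerm≡π i)))

  removedSign≡b : removedSign ε⁺ (predecessorOfTop τ) ≡ b
  removedSign≡b rewrite predecessorOfTop≡j = trans (insertSigns-just-inject₁ π ε k b j) (if-true _ _ (≡ᵇ-refl j))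

remove-insert-just : ∀ (π : Vec (Fin n) n) ε k b → Injective _≡_ _≡_ (lookup π) →
                     remove (insert ((π , ε) , (just k , b))) ≡ ((π , ε) , (just k , b))
remove-insert-just π ε k b inj
  rewrite insertPerm-just-fromℕ π k | ≢⇒≡ᵇ-false (inject₁≢fromℕ (lookup π (lookup π k))) =
  cong₂ _,_ (cong₂ _,_ (vec-ext _ π removePerm≡π) (vec-ext _ ε removeSigns≡ε)) (cong₂ _,_ find≡k removedSign≡b)
  where open RemoveInsertJust π ε k b inj

remove-insert : ∀ (σc : SignedPerm n × Choice n) → isPerm (proj₁ (proj₁ σc)) ≡ true → remove (insert σc) ≡ σc
remove-insert ((π , ε) , (nothing , b)) _    = remove-insert-nothing π ε b
remove-insert ((π , ε) , (just k , b))  perm = remove-insert-just π ε k b (isPerm⇒injective π perm)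

isPerm-insert : ∀ (σc : SignedPerm n × Choice n) → isPerm (proj₁ (proj₁ σc)) ≡ true → isPerm (proj₁ (insert σc)) ≡ true
isPerm-insert ((π , ε) , (c , b)) perm =
  injective⇒isPerm (tabulate (insertPerm π c)) (tabulate-injective _ (insertPerm-injective π c (isPerm⇒injective π perm)))

module RemoveFromPerm (τ : Vec (Fin (suc n)) (suc n)) (ε : Vec Bool (suc n)) (inj : Injective _≡_ _≡_ (lookup τ)) where
  top = fromℕ n

  module TopFixed (τtop≡top : lookup τ top ≡ top) where
    π⁻ : Vec (Fin n) n
    π⁻ = tabulate (λ i → lower i (lookup τ (inject₁ i)))

    inject₁-π⁻ : ∀ i → inject₁ (lookup π⁻ i) ≡ lookup τ (inject₁ i)
    inject₁-π⁻ i = trans (cong inject₁ (Vecₚ.lookup∘tabulate _ i))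
      (inject₁-lower i _ (λ e → inject₁≢fromℕ i (inj (trans e (sym τtop≡top)))))

    π⁻-injective : Injective _≡_ _≡_ (lookup π⁻)
    π⁻-injective e = Finₚ.inject₁-injective (inj (trans (sym (inject₁-π⁻ _)) (trans (cong inject₁ e) (inject₁-π⁻ _))))

  module TopMoved (τtop≢top : lookup τ top ≢ top) where
    j-exists : ∃ λ j → lookup τ (inject₁ j) ≡ top
    j-exists with injective⇒surjective (lookup τ) inj top
    ... | x , τx≡top with view x
    ...   | ‵fromℕ     = ⊥-elim (τtop≢top τx≡top)
    ...   | ‵inject₁ i = i , τx≡top

    j = proj₁ j-exists
    τj≡top = proj₂ j-exists

    predecessorOfTop≡j : predecessorOfTop τ ≡ just j
    predecessorOfTop≡j = find-unique _ j (trans (cong (_≡ᵇ top) τj≡top) (≡ᵇ-refl top))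
      (λ i e → Finₚ.inject₁-injective (inj (trans (≡ᵇ-true⇒≡ e) (sym τj≡top))))

    -- the successor of i once n+1 is skipped
    next : Fin n → Fin (suc n)
    next i = if i ≡ᵇ j then lookup τ top else lookup τ (inject₁ i)

    next≢top : ∀ i → next i ≢ top
    next≢top i with i ≡ᵇ j in ij
    ... | true  = τtop≢top
    ... | false = λ e → ≡ᵇ-false⇒≢ ij (Finₚ.inject₁-injective (inj (trans e (sym τj≡top))))

    next-injective : Injective _≡_ _≡_ next
    next-injective {a} {b} e with a ≡ᵇ j in aj | b ≡ᵇ j in bj
    ... | true  | true  = trans (≡ᵇ-true⇒≡ aj) (sym (≡ᵇ-true⇒≡ bj))
    ... | true  | false = ⊥-elim (inject₁≢fromℕ b (inj (sym e)))
    ... | false | true  = ⊥-elim (inject₁≢fromℕ a (inj e))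
    ... | false | false = Finₚ.inject₁-injective (inj e)

    π⁻ : Vec (Fin n) n
    π⁻ = tabulate (removePerm τ)

    removePerm≡lower-next : ∀ i → removePerm τ i ≡ lower i (next i)
    removePerm≡lower-next i rewrite predecessorOfTop≡j with i ≡ᵇ j
    ... | true  = refl
    ... | false = refl

    removeSigns≡ : ∀ i → removeSigns τ ε i ≡ (if i ≡ᵇ j then lookup ε top else lookup ε (inject₁ i))
    removeSigns≡ i rewrite predecessorOfTop≡j = refl

    inject₁-π⁻ : ∀ i → inject₁ (lookup π⁻ i) ≡ next i
    inject₁-π⁻ i = trans (cong inject₁ (trans (Vecₚ.lookup∘tabulate _ i) (removePerm≡lower-next i)))
                        (inject₁-lower i _ (next≢top i))

    π⁻-injective : Injective _≡_ _≡_ (lookup π⁻)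
    π⁻-injective e = next-injective (trans (sym (inject₁-π⁻ _)) (trans (cong inject₁ e) (inject₁-π⁻ _)))

    k-exists : ∃ λ k → lookup π⁻ k ≡ j
    k-exists = injective⇒surjective (lookup π⁻) π⁻-injective j

    k = proj₁ k-exists
    π⁻k≡j = proj₂ k-exists

    find≡k : find (matches (predecessorOfTop τ) ∘ removePerm τ) ≡ just k
    find≡k = trans (find-cong _ (λ i → lookup π⁻ i ≡ᵇ j) same)
                   (find-unique _ k (trans (cong (_≡ᵇ j) π⁻k≡j) (≡ᵇ-refl j))
                                    (λ i e → π⁻-injective (trans (≡ᵇ-true⇒≡ e) (sym π⁻k≡j))))
      where
      same : ∀ i → matches (predecessorOfTop τ) (removePerm τ i) ≡ (lookup π⁻ i ≡ᵇ j)
      same i = trans (cong (λ c → matches c (removePerm τ i)) predecessorOfTop≡j)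
                     (cong (_≡ᵇ j) (sym (Vecₚ.lookup∘tabulate (removePerm τ) i)))

isPerm-remove : ∀ (τ : SignedPerm (suc n)) → isPerm (proj₁ τ) ≡ true → isPerm (proj₁ (proj₁ (remove τ))) ≡ true
isPerm-remove {n} (τ , ε) perm with lookup τ (fromℕ n) ≡ᵇ fromℕ n in τtop
... | true  = injective⇒isPerm π⁻ π⁻-injective
  where open RemoveFromPerm τ ε (isPerm⇒injective τ perm)
        open TopFixed (≡ᵇ-true⇒≡ τtop)
... | false = injective⇒isPerm π⁻ π⁻-injective
  where open RemoveFromPerm τ ε (isPerm⇒injective τ perm)
        open TopMoved (≡ᵇ-false⇒≢ τtop)

insert-remove : ∀ (τ : SignedPerm (suc n)) → isPerm (proj₁ τ) ≡ true → insert (remove τ) ≡ τ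
insert-remove {n} (τ , ε) perm with lookup τ (fromℕ n) ≡ᵇ fromℕ n in τtop
... | true = cong₂ _,_ (tabulate-extend τ _ _ inject₁-π⁻ (sym (≡ᵇ-true⇒≡ τtop)))
                       (tabulate-extend ε _ _ (λ i → Vecₚ.lookup∘tabulate (lookup ε ∘ inject₁) i) refl)
  where
  open RemoveFromPerm τ ε (isPerm⇒injective τ perm)
  open TopFixed (≡ᵇ-true⇒≡ τtop)
... | false = begin
  insert ((π⁻ , ε⁻) , (find (matches (predecessorOfTop τ) ∘ removePerm τ) , removedSign ε (predecessorOfTop τ)))
    ≡⟨ cong₂ (λ c b → insert ((π⁻ , ε⁻) , (c , b))) find≡k (cong (removedSign ε) predecessorOfTop≡j) ⟩
  insert ((π⁻ , ε⁻) , (just k , lookup ε (inject₁ j)))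
    ≡⟨ cong₂ _,_ (tabulate-extend τ _ _ τ-inject₁ τ-top) (tabulate-extend ε _ _ ε-inject₁ ε-top) ⟩
  (τ , ε) ∎
  where
  open RemoveFromPerm τ ε (isPerm⇒injective τ perm)
  open TopMoved (≡ᵇ-false⇒≢ τtop)
  open ≡-Reasoning
  ε⁻ = tabulate (removeSigns τ ε)

  τ-inject₁ : ∀ i → (if i ≡ᵇ lookup π⁻ k then fromℕ n else inject₁ (lookup π⁻ i)) ≡ lookup τ (inject₁ i)
  τ-inject₁ i = trans (cong (λ j′ → if i ≡ᵇ j′ then fromℕ n else inject₁ (lookup π⁻ i)) π⁻k≡j) (byCase (i ≡ᵇ j) refl)
    where
    byCase : ∀ c → (i ≡ᵇ j) ≡ c → (if c then fromℕ n else inject₁ (lookup π⁻ i)) ≡ lookup τ (inject₁ i)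
    byCase true  ij = trans (sym τj≡top) (cong (lookup τ ∘ inject₁) (sym (≡ᵇ-true⇒≡ ij)))
    byCase false ij = trans (inject₁-π⁻ i) (if-false _ _ ij)

  τ-top : inject₁ (lookup π⁻ (lookup π⁻ k)) ≡ lookup τ (fromℕ n)
  τ-top = trans (cong (inject₁ ∘ lookup π⁻) π⁻k≡j) (trans (inject₁-π⁻ j) (if-true _ _ (≡ᵇ-refl j)))

  ε⁻-value : ∀ i → lookup ε⁻ i ≡ (if i ≡ᵇ j then lookup ε (fromℕ n) else lookup ε (inject₁ i))
  ε⁻-value i = trans (Vecₚ.lookup∘tabulate (removeSigns τ ε) i) (removeSigns≡ i)

  ε-inject₁ : ∀ i → (if i ≡ᵇ lookup π⁻ k then lookup ε (inject₁ j) else lookup ε⁻ i) ≡ lookup ε (inject₁ i)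
  ε-inject₁ i = trans (cong (λ j′ → if i ≡ᵇ j′ then lookup ε (inject₁ j) else lookup ε⁻ i) π⁻k≡j) (byCase (i ≡ᵇ j) refl)
    where
    byCase : ∀ c → (i ≡ᵇ j) ≡ c → (if c then lookup ε (inject₁ j) else lookup ε⁻ i) ≡ lookup ε (inject₁ i)
    byCase true  ij = cong (lookup ε ∘ inject₁) (sym (≡ᵇ-true⇒≡ ij))
    byCase false ij = trans (ε⁻-value i) (if-false _ _ ij)

  ε-top : lookup ε⁻ (lookup π⁻ k) ≡ lookup ε (fromℕ n)
  ε-top = trans (cong (lookup ε⁻) π⁻k≡j) (trans (ε⁻-value j) (if-true _ _ (≡ᵇ-refl j)))

-- Statistics under insertion

sum-exchange : ∀ (f g : Fin n → ℕ) x → (∀ i → i ≢ x → f i ≡ g i) → sum f + g x ≡ sum g + f x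
sum-exchange {suc n} f g x f≗g = begin
  sum f + g x                              ≡⟨ cong (_+ g x) (sum-remove {i = x} f) ⟩
  f x + sum (f ∘ Fin.punchIn x) + g x      ≡⟨ cong (λ r → f x + r + g x) (sum-cong-≗ λ i → f≗g _ (Finₚ.punchInᵢ≢i x i)) ⟩
  f x + sum (g ∘ Fin.punchIn x) + g x      ≡⟨ solve 3 (λ a r c → (a :+ r) :+ c := (c :+ r) :+ a) refl (f x) _ (g x) ⟩
  g x + sum (g ∘ Fin.punchIn x) + f x      ≡⟨ cong (_+ f x) (sum-remove {i = x} g) ⟨
  sum g + f x                              ∎
  where open ≡-Reasoning

sum-exchange₂ : ∀ (f g : Fin n → ℕ) x y → x ≢ y → (∀ i → i ≢ x → i ≢ y → f i ≡ g i) →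
                sum f + g x + g y ≡ sum g + f x + f y
sum-exchange₂ f g x y x≢y f≗g = begin
  sum f + g x + g y  ≡⟨ solve 3 (λ a b c → (a :+ b) :+ c := (a :+ c) :+ b) refl (sum f) (g x) (g y) ⟩
  sum f + g y + g x  ≡⟨ cong (_+ g x) (trans (cong (sum f +_) (sym hy)) (sum-exchange f h y f≗h)) ⟩
  sum h + f y + g x  ≡⟨ solve 3 (λ a b c → (a :+ b) :+ c := (a :+ c) :+ b) refl (sum h) (f y) (g x) ⟩
  sum h + g x + f y  ≡⟨ cong (_+ f y) (sum-exchange h g x h≗g) ⟩
  sum g + h x + f y  ≡⟨ cong (λ z → sum g + z + f y) hx ⟩
  sum g + f x + f y  ∎
  where
  open ≡-Reasoning
  h : Fin _ → ℕ
  h i = if i ≡ᵇ y then g y else f i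
  hy : h y ≡ g y
  hy = if-true _ _ (≡ᵇ-refl y)
  f≗h : ∀ i → i ≢ y → f i ≡ h i
  f≗h i i≢y = sym (if-false _ _ (≢⇒≡ᵇ-false i≢y))
  hx : h x ≡ f x
  hx = if-false _ _ (≢⇒≡ᵇ-false x≢y)
  h≗g : ∀ i → i ≢ x → h i ≡ g i
  h≗g i i≢x with i ≡ᵇ y in iy
  ... | true  = cong g (sym (≡ᵇ-true⇒≡ iy))
  ... | false = f≗g i i≢x (≡ᵇ-false⇒≢ iy)

data Status : Set where
  excedance antiExcedance fixedPoint singleton : Status

-- holds S a c k: position k+1, with σ(k+1) = a and σ(|σ(k+1)|) = c, has status S
holds : Status → ℤ → ℤ → ℕ → Bool
holds excedance     a c k = does (a ℤ.<? c)
holds antiExcedance a c k = does (c ℤ.<? a)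
holds fixedPoint    a c k = does (a ℤ.≟ ℤ.+ suc k)
holds singleton     a c k = does (a ℤ.≟ -[1+ k ])

hasStatus : Status → Vec (Fin n) n → Vec Bool n → Fin n → Bool
hasStatus S π ε i = holds S (σ π ε i) (σσ π ε i) (toℕ i)

count : Status → Vec (Fin n) n → Vec Bool n → ℕ
count {n} S π ε = countB (hasStatus S π ε) (List.allFin n)

count≡sum : ∀ S (π : Vec (Fin n) n) ε → count S π ε ≡ sum (λ i → ⟦ hasStatus S π ε i ⟧)
count≡sum S π ε = countB-tabulate (hasStatus S π ε) id

holds-cong : ∀ S {a a′ c c′ k k′} → a ≡ a′ → c ≡ c′ → k ≡ k′ → holds S a c k ≡ holds S a′ c′ k′
holds-cong S refl refl refl = refl

-- σ π ε i reduces to signed (lookup ε i) (toℕ (lookup π i)).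
signed : Bool → ℕ → ℤ
signed b m = if b then -[1+ m ] else ℤ.+ suc m

module _ {m n : ℕ} (m<n : m ℕ.< n) where

  signed<+[1+n] : ∀ e → signed e m ℤ.< ℤ.+ suc n
  signed<+[1+n] true  = ℤ.-<+
  signed<+[1+n] false = ℤ.+<+ (ℕ.s≤s m<n)

  -[1+n]<signed : ∀ e → -[1+ n ] ℤ.< signed e m
  -[1+n]<signed true  = ℤ.-<- m<n
  -[1+n]<signed false = ℤ.-<+

  signed<new : ∀ e b → does (signed e m ℤ.<? signed b n) ≡ not b
  signed<new e false = dec-true (signed e m ℤ.<? _) (signed<+[1+n] e)
  signed<new e true  = dec-false (signed e m ℤ.<? _) (ℤₚ.<-asym (-[1+n]<signed e))

  new<signed : ∀ e b → does (signed b n ℤ.<? signed e m) ≡ b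
  new<signed e false = dec-false (_ ℤ.<? signed e m) (ℤₚ.<-asym (signed<+[1+n] e))
  new<signed e true  = dec-true (_ ℤ.<? signed e m) (-[1+n]<signed e)

  signed≢+[1+n] : ∀ e → does (signed e m ℤ.≟ ℤ.+ suc n) ≡ false
  signed≢+[1+n] e = dec-false (signed e m ℤ.≟ _) (ℤₚ.<⇒≢ (signed<+[1+n] e))

  signed≢-[1+n] : ∀ e → does (signed e m ℤ.≟ -[1+ n ]) ≡ false
  signed≢-[1+n] e = dec-false (signed e m ℤ.≟ _) (ℤₚ.<⇒≢ (-[1+n]<signed e) ∘ sym)

  new≢+[1+m] : ∀ b → does (signed b n ℤ.≟ ℤ.+ suc m) ≡ false
  new≢+[1+m] true  = refl
  new≢+[1+m] false = dec-false (ℤ.+ suc n ℤ.≟ _) (ℤₚ.<⇒≢ (signed<+[1+n] false) ∘ sym)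

  new≢-[1+m] : ∀ b → does (signed b n ℤ.≟ -[1+ m ]) ≡ false
  new≢-[1+m] false = refl
  new≢-[1+m] true  = dec-false (-[1+ n ] ℤ.≟ _) (ℤₚ.<⇒≢ (-[1+n]<signed true))

<?-irrefl : ∀ a → does (a ℤ.<? a) ≡ false
<?-irrefl a = dec-false (a ℤ.<? a) (ℤₚ.<-irrefl refl)

signed≢+[1+k] : ∀ e a k → a ≢ k → does (signed e a ℤ.≟ ℤ.+ suc k) ≡ false
signed≢+[1+k] true  a k a≢k = refl
signed≢+[1+k] false a k a≢k = dec-false (ℤ.+ suc a ℤ.≟ _) (a≢k ∘ ℕₚ.suc-injective ∘ ℤₚ.+-injective)

signed≢-[1+k] : ∀ e a k → a ≢ k → does (signed e a ℤ.≟ -[1+ k ]) ≡ false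
signed≢-[1+k] false a k a≢k = refl
signed≢-[1+k] true  a k a≢k = dec-false (-[1+ a ] ℤ.≟ _) (a≢k ∘ ℤₚ.-[1+-injective)

countB-allFin-suc : ∀ (P : Fin (suc n) → Bool) (Q : Fin n → Bool) → (∀ i → P (inject₁ i) ≡ Q i) →
                    countB P (List.allFin (suc n)) ≡ countB Q (List.allFin n) + ⟦ P (fromℕ n) ⟧
countB-allFin-suc {n} P Q P≗Q = begin
  countB P (List.allFin (suc n))                      ≡⟨ countB-tabulate P id ⟩
  sum (λ x → ⟦ P x ⟧)                                 ≡⟨ sum-init-last (λ x → ⟦ P x ⟧) ⟩
  sum (λ i → ⟦ P (inject₁ i) ⟧) + ⟦ P (fromℕ n) ⟧      ≡⟨ cong (_+ _) (sum-cong-≗ (cong ⟦_⟧ ∘ P≗Q)) ⟩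
  sum (λ i → ⟦ Q i ⟧) + ⟦ P (fromℕ n) ⟧                ≡⟨ cong (_+ _) (countB-tabulate Q id) ⟨
  countB Q (List.allFin n) + ⟦ P (fromℕ n) ⟧           ∎
  where open ≡-Reasoning

topStatus : Bool → Status → Bool
topStatus b excedance     = false
topStatus b antiExcedance = false
topStatus b fixedPoint    = not b
topStatus b singleton     = b

module InsertNothing (π : Vec (Fin n) n) (ε : Vec Bool n) (b : Bool) where
  τ = tabulate (insertPerm π nothing)
  ε⁺ = tabulate (insertSigns π ε nothing b)

  σ-inject₁ : ∀ i → σ τ ε⁺ (inject₁ i) ≡ σ π ε i
  σ-inject₁ i rewrite insertSigns-nothing-inject₁ π ε b i | insertPerm-nothing-inject₁ π i =
    cong (signed (lookup ε i)) (Finₚ.toℕ-inject₁ (lookup π i))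

  σ-top : σ τ ε⁺ (fromℕ n) ≡ signed b n
  σ-top rewrite insertSigns-nothing-fromℕ π ε b | insertPerm-nothing-fromℕ π = cong (signed b) (Finₚ.toℕ-fromℕ n)

  σσ-inject₁ : ∀ i → σσ τ ε⁺ (inject₁ i) ≡ σσ π ε i
  σσ-inject₁ i = trans (cong (σ τ ε⁺) (insertPerm-nothing-inject₁ π i)) (σ-inject₁ (lookup π i))

  σσ-top : σσ τ ε⁺ (fromℕ n) ≡ signed b n
  σσ-top = trans (cong (σ τ ε⁺) (insertPerm-nothing-fromℕ π)) σ-top

  hasStatus-top : ∀ S → hasStatus S τ ε⁺ (fromℕ n) ≡ topStatus b S
  hasStatus-top S = trans (holds-cong S σ-top σσ-top (Finₚ.toℕ-fromℕ n)) (lemma S b)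
    where
    lemma : ∀ S b → holds S (signed b n) (signed b n) n ≡ topStatus b S
    lemma excedance     b     = <?-irrefl (signed b n)
    lemma antiExcedance b     = <?-irrefl (signed b n)
    lemma fixedPoint    true  = refl
    lemma fixedPoint    false = dec-true (ℤ.+ suc n ℤ.≟ ℤ.+ suc n) refl
    lemma singleton     true  = dec-true (-[1+ n ] ℤ.≟ -[1+ n ]) refl
    lemma singleton     false = refl

  count-insert-nothing : ∀ S → count S τ ε⁺ ≡ count S π ε + ⟦ topStatus b S ⟧
  count-insert-nothing S = trans
    (countB-allFin-suc (hasStatus S τ ε⁺) (hasStatus S π ε)
      (λ i → holds-cong S (σ-inject₁ i) (σσ-inject₁ i) (Finₚ.toℕ-inject₁ i)))
    (cong (λ z → count S π ε + ⟦ z ⟧) (hasStatus-top S))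

  neg-insert-nothing : neg τ ε⁺ ≡ neg π ε + ⟦ b ⟧
  neg-insert-nothing = trans (countB-allFin-suc (lookup ε⁺) (lookup ε) (insertSigns-nothing-inject₁ π ε b))
                             (cong (λ z → neg π ε + ⟦ z ⟧) (insertSigns-nothing-fromℕ π ε b))

isExcOrAexc : Status → Bool
isExcOrAexc excedance     = true
isExcOrAexc antiExcedance = true
isExcOrAexc fixedPoint    = false
isExcOrAexc singleton     = false

-- After inserting n+1 with sign b right after j = |σ(k)|, the statuses of positions k and j.
kStatus jStatus : Bool → Status → Bool
kStatus b excedance     = not b
kStatus b antiExcedance = b
kStatus b fixedPoint    = false
kStatus b singleton     = false
jStatus b excedance     = b
jStatus b antiExcedance = not b
jStatus b fixedPoint    = false
jStatus b singleton     = false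

kStatus+jStatus : ∀ b S → ⟦ kStatus b S ⟧ + ⟦ jStatus b S ⟧ ≡ ⟦ isExcOrAexc S ⟧
kStatus+jStatus true  excedance     = refl
kStatus+jStatus false excedance     = refl
kStatus+jStatus true  antiExcedance = refl
kStatus+jStatus false antiExcedance = refl
kStatus+jStatus b     fixedPoint    = refl
kStatus+jStatus b     singleton     = refl

module _ {n : ℕ} (b : Bool) where

  holds-into-new : ∀ S e m k → m ℕ.< n → does (signed e m ℤ.≟ ℤ.+ suc k) ≡ false →
                   does (signed e m ℤ.≟ -[1+ k ]) ≡ false → holds S (signed e m) (signed b n) k ≡ kStatus b S
  holds-into-new excedance     e m k m<n _ _ = signed<new m<n e b
  holds-into-new antiExcedance e m k m<n _ _ = new<signed m<n e b
  holds-into-new fixedPoint    e m k m<n f _ = f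
  holds-into-new singleton     e m k m<n _ s = s

  holds-from-new : ∀ S e m k → m ℕ.< n → k ℕ.< n → holds S (signed b n) (signed e m) k ≡ jStatus b S
  holds-from-new excedance     e m k m<n k<n = new<signed m<n e b
  holds-from-new antiExcedance e m k m<n k<n = signed<new m<n e b
  holds-from-new fixedPoint    e m k m<n k<n = new≢+[1+m] k<n b
  holds-from-new singleton     e m k m<n k<n = new≢-[1+m] k<n b

module InsertJust (π : Vec (Fin n) n) (ε : Vec Bool n) (inj : Injective _≡_ _≡_ (lookup π)) (k : Fin n) (b : Bool) where
  j = lookup π k
  τ = tabulate (insertPerm π (just k))
  ε⁺ = tabulate (insertSigns π ε (just k) b)

  σ-inject₁ : ∀ i → σ τ ε⁺ (inject₁ i) ≡ (if i ≡ᵇ j then signed b n else σ π ε i)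
  σ-inject₁ i rewrite insertSigns-just-inject₁ π ε k b i | insertPerm-just-inject₁ π k i with i ≡ᵇ j
  ... | true  = cong (signed b) (Finₚ.toℕ-fromℕ n)
  ... | false = cong (signed (lookup ε i)) (Finₚ.toℕ-inject₁ (lookup π i))

  σ-top : σ τ ε⁺ (fromℕ n) ≡ σ π ε j
  σ-top rewrite insertSigns-just-fromℕ π ε k b | insertPerm-just-fromℕ π k =
    cong (signed (lookup ε j)) (Finₚ.toℕ-inject₁ (lookup π j))

  σ-off : ∀ i → i ≢ j → σ τ ε⁺ (inject₁ i) ≡ σ π ε i
  σ-off i i≢j = trans (σ-inject₁ i) (if-false _ _ (≢⇒≡ᵇ-false i≢j))

  σ-j : σ τ ε⁺ (inject₁ j) ≡ signed b n
  σ-j = trans (σ-inject₁ j) (if-true _ _ (≡ᵇ-refl j))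

  σσ-off : ∀ i → i ≢ j → σσ τ ε⁺ (inject₁ i) ≡ σ τ ε⁺ (inject₁ (lookup π i))
  σσ-off i i≢j = cong (σ τ ε⁺) (trans (insertPerm-just-inject₁ π k i) (if-false _ _ (≢⇒≡ᵇ-false i≢j)))

  σσ-j : σσ τ ε⁺ (inject₁ j) ≡ σ π ε j
  σσ-j = trans (cong (σ τ ε⁺) (trans (insertPerm-just-inject₁ π k j) (if-true _ _ (≡ᵇ-refl j)))) σ-top

  σσ-top : σσ τ ε⁺ (fromℕ n) ≡ σ τ ε⁺ (inject₁ (lookup π j))
  σσ-top = cong (σ τ ε⁺) (insertPerm-just-fromℕ π k)

  hasStatus-off : ∀ S i → i ≢ j → i ≢ k → hasStatus S τ ε⁺ (inject₁ i) ≡ hasStatus S π ε i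
  hasStatus-off S i i≢j i≢k =
    holds-cong S (σ-off i i≢j) (trans (σσ-off i i≢j) (σ-off (lookup π i) (i≢k ∘ inj))) (Finₚ.toℕ-inject₁ i)

  hasStatus-j : ∀ S → hasStatus S τ ε⁺ (inject₁ j) ≡ jStatus b S
  hasStatus-j S = trans (holds-cong S σ-j σσ-j (Finₚ.toℕ-inject₁ j))
    (holds-from-new b S (lookup ε j) (toℕ (lookup π j)) (toℕ j) (Finₚ.toℕ<n _) (Finₚ.toℕ<n j))

  hasStatus-k : k ≢ j → ∀ S → hasStatus S τ ε⁺ (inject₁ k) ≡ kStatus b S
  hasStatus-k k≢j S = trans (holds-cong S (σ-off k k≢j) (trans (σσ-off k k≢j) σ-j) (Finₚ.toℕ-inject₁ k))
    (holds-into-new b S (lookup ε k) (toℕ j) (toℕ k) (Finₚ.toℕ<n j)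
      (signed≢+[1+k] (lookup ε k) (toℕ j) (toℕ k) j≢k) (signed≢-[1+k] (lookup ε k) (toℕ j) (toℕ k) j≢k))
    where
    j≢k : toℕ j ≢ toℕ k
    j≢k = k≢j ∘ sym ∘ Finₚ.toℕ-injective

  hasStatus-top-k≢j : k ≢ j → ∀ S → hasStatus S τ ε⁺ (fromℕ n) ≡ hasStatus S π ε j
  hasStatus-top-k≢j k≢j = lemma
    where
    πj≢j : toℕ (lookup π j) ≢ toℕ j
    πj≢j e = k≢j (inj (sym (Finₚ.toℕ-injective e)))
    σσ≡ : σσ τ ε⁺ (fromℕ n) ≡ σσ π ε j
    σσ≡ = trans σσ-top (σ-off (lookup π j) (πj≢j ∘ cong toℕ))
    e = lookup ε j
    m<n = Finₚ.toℕ<n (lookup π j)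
    lemma : ∀ S → hasStatus S τ ε⁺ (fromℕ n) ≡ hasStatus S π ε j
    lemma excedance     = cong₂ (λ a c → does (a ℤ.<? c)) σ-top σσ≡
    lemma antiExcedance = cong₂ (λ a c → does (c ℤ.<? a)) σ-top σσ≡
    lemma fixedPoint    = trans (holds-cong fixedPoint σ-top (refl {x = σσ τ ε⁺ (fromℕ n)}) (Finₚ.toℕ-fromℕ n))
      (trans (signed≢+[1+n] m<n e) (sym (signed≢+[1+k] e _ _ πj≢j)))
    lemma singleton     = trans (holds-cong singleton σ-top (refl {x = σσ τ ε⁺ (fromℕ n)}) (Finₚ.toℕ-fromℕ n))
      (trans (signed≢-[1+n] m<n e) (sym (signed≢-[1+k] e _ _ πj≢j)))

  hasStatus-top-k≡j : k ≡ j → ∀ S → hasStatus S τ ε⁺ (fromℕ n) ≡ kStatus b S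
  hasStatus-top-k≡j k≡j S =
    trans (holds-cong S σ-top (trans σσ-top (trans (cong (σ τ ε⁺ ∘ inject₁) πj≡j) σ-j)) (Finₚ.toℕ-fromℕ n))
      (holds-into-new b S e (toℕ (lookup π j)) n m<n (signed≢+[1+n] m<n e) (signed≢-[1+n] m<n e))
    where
    πj≡j : lookup π j ≡ j
    πj≡j = subst (λ z → lookup π z ≡ j) k≡j refl
    e = lookup ε j
    m<n = Finₚ.toℕ<n (lookup π j)

  -- Only positions k, j and n+1 change: k and j become an excedance and an anti-excedance,
  -- and n+1 takes over the old status of j (or, when k = j, the new status of k).
  count-insert-just : ∀ S → count S τ ε⁺ + ⟦ hasStatus S π ε k ⟧ ≡ count S π ε + ⟦ isExcOrAexc S ⟧
  count-insert-just S = trans (cong (_+ old k) (trans (count≡sum S τ ε⁺) (sum-init-last (λ x → ⟦ hasStatus S τ ε⁺ x ⟧))))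
                              (byCase (k ≟ j))
    where
    open ≡-Reasoning
    new old : Fin n → ℕ
    new i = ⟦ hasStatus S τ ε⁺ (inject₁ i) ⟧
    old i = ⟦ hasStatus S π ε i ⟧
    newTop = ⟦ hasStatus S τ ε⁺ (fromℕ n) ⟧
    K = ⟦ kStatus b S ⟧
    J′ = ⟦ jStatus b S ⟧
    new≗old : ∀ i → i ≢ j → i ≢ k → new i ≡ old i
    new≗old i i≢j i≢k = cong ⟦_⟧ (hasStatus-off S i i≢j i≢k)

    byCase : Dec (k ≡ j) → sum new + newTop + old k ≡ count S π ε + ⟦ isExcOrAexc S ⟧
    byCase (no k≢j) = begin
      sum new + newTop + old k  ≡⟨ cong (λ z → sum new + ⟦ z ⟧ + old k) (hasStatus-top-k≢j k≢j S) ⟩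
      sum new + old j + old k   ≡⟨ solve 3 (λ a c d → (a :+ c) :+ d := (a :+ d) :+ c) refl (sum new) (old j) (old k) ⟩
      sum new + old k + old j   ≡⟨ sum-exchange₂ new old k j k≢j (λ i i≢k i≢j → new≗old i i≢j i≢k) ⟩
      sum old + new k + new j   ≡⟨ cong₂ (λ u v → sum old + ⟦ u ⟧ + ⟦ v ⟧) (hasStatus-k k≢j S) (hasStatus-j S) ⟩
      sum old + K + J′          ≡⟨ ℕₚ.+-assoc (sum old) K J′ ⟩
      sum old + (K + J′)        ≡⟨ cong₂ _+_ (sym (count≡sum S π ε)) (kStatus+jStatus b S) ⟩
      count S π ε + ⟦ isExcOrAexc S ⟧ ∎
    byCase (yes k≡j) = begin
      sum new + newTop + old k  ≡⟨ cong (sum new + newTop +_) (cong old k≡j) ⟩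
      sum new + newTop + old j  ≡⟨ solve 3 (λ a c d → (a :+ c) :+ d := (a :+ d) :+ c) refl (sum new) newTop (old j) ⟩
      sum new + old j + newTop  ≡⟨ cong (_+ newTop) (sum-exchange new old j (λ i i≢j → new≗old i i≢j (i≢j ∘ flip trans k≡j))) ⟩
      sum old + new j + newTop  ≡⟨ cong₂ (λ u v → sum old + ⟦ u ⟧ + ⟦ v ⟧) (hasStatus-j S) (hasStatus-top-k≡j k≡j S) ⟩
      sum old + J′ + K          ≡⟨ ℕₚ.+-assoc (sum old) J′ K ⟩
      sum old + (J′ + K)        ≡⟨ cong₂ _+_ (sym (count≡sum S π ε)) (trans (ℕₚ.+-comm J′ K) (kStatus+jStatus b S)) ⟩
      count S π ε + ⟦ isExcOrAexc S ⟧ ∎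

  neg-insert-just : neg τ ε⁺ ≡ neg π ε + ⟦ b ⟧
  neg-insert-just = begin
    neg τ ε⁺
      ≡⟨ countB-allFin-suc (lookup ε⁺) (lookup ε⁺ ∘ inject₁) (λ _ → refl) ⟩
    countB (lookup ε⁺ ∘ inject₁) (List.allFin n) + ⟦ lookup ε⁺ (fromℕ n) ⟧
      ≡⟨ cong₂ _+_ (countB-tabulate (lookup ε⁺ ∘ inject₁) id) (cong ⟦_⟧ (insertSigns-just-fromℕ π ε k b)) ⟩
    sum new + old j                                      ≡⟨ sum-exchange new old j new≗old ⟩
    sum old + new j                                      ≡⟨ cong₂ _+_ (sym (countB-tabulate (lookup ε) id)) new-j ⟩
    neg π ε + ⟦ b ⟧                                      ∎
    where
    open ≡-Reasoning
    new old : Fin n → ℕ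
    new i = ⟦ lookup ε⁺ (inject₁ i) ⟧
    old i = ⟦ lookup ε i ⟧
    new≗old : ∀ i → i ≢ j → new i ≡ old i
    new≗old i i≢j = cong ⟦_⟧ (trans (insertSigns-just-inject₁ π ε k b i) (if-false _ _ (≢⇒≡ᵇ-false i≢j)))
    new-j : new j ≡ ⟦ b ⟧
    new-j = cong ⟦_⟧ (trans (insertSigns-just-inject₁ π ε k b j) (if-true _ _ (≡ᵇ-refl j)))

-- Cycles under insertion

isCycleMin : Vec (Fin n) n → Vec Bool n → Fin n → Bool
isCycleMin {n} π ε i = allB (λ k → does (toℕ i ℕ.≤? toℕ (πpow π ε k i))) (List.upTo (suc n))

bool-ext : ∀ {a b : Bool} → (a ≡ true → b ≡ true) → (b ≡ true → a ≡ true) → a ≡ b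
bool-ext {true}  {true}  _ _ = refl
bool-ext {true}  {false} f _ = sym (f refl)
bool-ext {false} {true}  _ g = g refl
bool-ext {false} {false} _ _ = refl

module Orbits (π : Vec (Fin n) n) (ε : Vec Bool n) where

  πpow-+ : ∀ a d i → πpow π ε (a + d) i ≡ πpow π ε a (πpow π ε d i)
  πpow-+ zero    d i = refl
  πpow-+ (suc a) d i = cong (lookup π) (πpow-+ a d i)

  IsCycleMin : Fin n → Set
  IsCycleMin i = ∀ k → toℕ i ≤ toℕ (πpow π ε k i)

  isCycleMin⁺ : ∀ i → IsCycleMin i → isCycleMin π ε i ≡ true
  isCycleMin⁺ i min = allB-applyUpTo _ (λ k → k) (suc n) (λ k _ → dec-true (_ ℕ.≤? _) (min k))

  module _ (inj : Injective _≡_ _≡_ (lookup π)) where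

    πpow-injective : ∀ a → Injective _≡_ _≡_ (πpow π ε a)
    πpow-injective zero    e = e
    πpow-injective (suc a) e = πpow-injective a (inj e)

    period : ∀ i → ∃ λ d → 0 < d × d ≤ n × πpow π ε d i ≡ i
    period i with x , y , x<y , e ← Finₚ.pigeonhole (ℕₚ.n<1+n n) (λ x → πpow π ε (toℕ x) i) =
      toℕ y ∸ toℕ x , ℕₚ.m<n⇒0<n∸m x<y , ℕₚ.≤-trans (ℕₚ.m∸n≤m (toℕ y) (toℕ x)) (ℕₚ.≤-pred (Finₚ.toℕ<n y)) ,
      πpow-injective (toℕ x) (trans (sym (πpow-+ (toℕ x) _ i))
        (trans (cong (λ z → πpow π ε z i) (ℕₚ.m+[n∸m]≡n (ℕₚ.<⇒≤ x<y))) (sym e)))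

    πpow-* : ∀ i d → πpow π ε d i ≡ i → ∀ q → πpow π ε (q * d) i ≡ i
    πpow-* i d pd zero    = refl
    πpow-* i d pd (suc q) = trans (πpow-+ d (q * d) i) (trans (cong (πpow π ε d) (πpow-* i d pd q)) pd)

    -- Every power of π on i is one of the first n, by periodicity.
    isCycleMin⁻ : ∀ i → isCycleMin π ε i ≡ true → IsCycleMin i
    isCycleMin⁻ i h k with period i
    ... | suc d′ , _ , d≤n , pd = subst (λ z → toℕ i ≤ toℕ z) (sym πk≡πr) (ℕₚ.≤ᵇ⇒≤ (toℕ i) _ (subst T (sym r-ok) _))
      where
      d = suc d′
      r = k % d
      πk≡πr : πpow π ε k i ≡ πpow π ε r i
      πk≡πr = trans (cong (λ z → πpow π ε z i) (m≡m%n+[m/n]*n k d))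
                    (trans (πpow-+ r ((k / d) * d) i) (cong (πpow π ε r) (πpow-* i d pd (k / d))))
      r-ok = allB-applyUpTo⁻ _ (λ k → k) (suc n) h r (ℕₚ.≤-trans (m%n<n k d) (ℕₚ.≤-trans d≤n (ℕₚ.n≤1+n n)))

module CycleInsertJust (π : Vec (Fin n) n) (ε : Vec Bool n) (inj : Injective _≡_ _≡_ (lookup π))
                       (k : Fin n) (b : Bool) where
  j = lookup π k
  τ = tabulate (insertPerm π (just k))
  ε⁺ = tabulate (insertSigns π ε (just k) b)
  module Oσ = Orbits π ε
  module Oτ = Orbits τ ε⁺

  τ-injective : Injective _≡_ _≡_ (lookup τ)
  τ-injective = tabulate-injective _ (insertPerm-injective π (just k) inj)

  -- The τ-orbit of i is the σ-orbit of i, with n+1 visited right after j.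
  τ-orbit : ∀ i m → (∃ λ l → πpow τ ε⁺ m (inject₁ i) ≡ inject₁ (πpow π ε l i)) ⊎
                    (πpow τ ε⁺ m (inject₁ i) ≡ fromℕ n × ∃ λ l → πpow π ε l i ≡ j)
  τ-orbit i zero = inj₁ (0 , refl)
  τ-orbit i (suc m) with τ-orbit i m
  ... | inj₂ (e , l , πl≡j) =
    inj₁ (suc l , trans (cong (lookup τ) e) (trans (insertPerm-just-fromℕ π k) (cong (inject₁ ∘ lookup π) (sym πl≡j))))
  ... | inj₁ (l , e) with πpow π ε l i ≡ᵇ j in lj
  ...   | true  = inj₂ (trans (cong (lookup τ) e) (trans (insertPerm-just-inject₁ π k (πpow π ε l i)) (if-true _ _ lj)) ,
                        l , ≡ᵇ-true⇒≡ lj)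
  ...   | false = inj₁ (suc l , trans (cong (lookup τ) e)
                                      (trans (insertPerm-just-inject₁ π k (πpow π ε l i)) (if-false (fromℕ n) _ lj)))

  σ-orbit : ∀ i l → ∃ λ m → πpow τ ε⁺ m (inject₁ i) ≡ inject₁ (πpow π ε l i)
  σ-orbit i zero = 0 , refl
  σ-orbit i (suc l) with σ-orbit i l
  ... | m , e with πpow π ε l i ≡ᵇ j in lj
  ...   | false = suc m , trans (cong (lookup τ) e) (trans (insertPerm-just-inject₁ π k (πpow π ε l i)) (if-false _ _ lj))
  ...   | true  = suc (suc m) , trans (cong (lookup τ ∘ lookup τ) e)
          (trans (cong (lookup τ) (trans (insertPerm-just-inject₁ π k (πpow π ε l i)) (if-true _ _ lj)))
            (trans (insertPerm-just-fromℕ π k) (cong (inject₁ ∘ lookup π) (sym (≡ᵇ-true⇒≡ lj)))))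

  isCycleMin-inject₁ : ∀ i → isCycleMin τ ε⁺ (inject₁ i) ≡ isCycleMin π ε i
  isCycleMin-inject₁ i = bool-ext
    (λ h → Oσ.isCycleMin⁺ i (τ-min⇒σ-min (Oτ.isCycleMin⁻ τ-injective (inject₁ i) h)))
    (λ h → Oτ.isCycleMin⁺ (inject₁ i) (σ-min⇒τ-min (Oσ.isCycleMin⁻ inj i h)))
    where
    σ-min⇒τ-min : Oσ.IsCycleMin i → Oτ.IsCycleMin (inject₁ i)
    σ-min⇒τ-min min m with τ-orbit i m
    ... | inj₁ (l , e) = subst (λ z → toℕ (inject₁ i) ≤ toℕ z) (sym e)
                           (subst₂ _≤_ (sym (Finₚ.toℕ-inject₁ i)) (sym (Finₚ.toℕ-inject₁ _)) (min l))
    ... | inj₂ (e , _) = subst (λ z → toℕ (inject₁ i) ≤ toℕ z) (sym e)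
                           (subst (toℕ (inject₁ i) ≤_) (sym (Finₚ.toℕ-fromℕ n)) (ℕₚ.<⇒≤ (Finₚ.inject₁ℕ< i)))

    τ-min⇒σ-min : Oτ.IsCycleMin (inject₁ i) → Oσ.IsCycleMin i
    τ-min⇒σ-min min l with m , e ← σ-orbit i l =
      subst₂ _≤_ (Finₚ.toℕ-inject₁ i) (Finₚ.toℕ-inject₁ _) (subst (λ z → toℕ (inject₁ i) ≤ toℕ z) e (min m))

  isCycleMin-top : isCycleMin τ ε⁺ (fromℕ n) ≡ false
  isCycleMin-top with isCycleMin τ ε⁺ (fromℕ n) in h
  ... | false = refl
  ... | true  = ⊥-elim (ℕₚ.<⇒≱ τtop<top (Oτ.isCycleMin⁻ τ-injective (fromℕ n) h 1))
    where
    τtop<top : toℕ (πpow τ ε⁺ 1 (fromℕ n)) < toℕ (fromℕ n)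
    τtop<top = subst₂ _<_ (cong toℕ (sym (insertPerm-just-fromℕ π k))) (sym (Finₚ.toℕ-fromℕ n)) (Finₚ.inject₁ℕ< _)

  cyc-insert-just : cyc τ ε⁺ ≡ cyc π ε
  cyc-insert-just = trans (countB-allFin-suc (isCycleMin τ ε⁺) (isCycleMin π ε) isCycleMin-inject₁)
                          (trans (cong (λ z → cyc π ε + ⟦ z ⟧) isCycleMin-top) (ℕₚ.+-identityʳ _))

module CycleInsertNothing (π : Vec (Fin n) n) (ε : Vec Bool n) (inj : Injective _≡_ _≡_ (lookup π)) (b : Bool) where
  τ = tabulate (insertPerm π nothing)
  ε⁺ = tabulate (insertSigns π ε nothing b)
  module Oσ = Orbits π ε
  module Oτ = Orbits τ ε⁺

  τ-injective : Injective _≡_ _≡_ (lookup τ)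
  τ-injective = tabulate-injective _ (insertPerm-injective π nothing inj)

  orbit-inject₁ : ∀ i m → πpow τ ε⁺ m (inject₁ i) ≡ inject₁ (πpow π ε m i)
  orbit-inject₁ i zero    = refl
  orbit-inject₁ i (suc m) = trans (cong (lookup τ) (orbit-inject₁ i m)) (insertPerm-nothing-inject₁ π _)

  orbit-top : ∀ m → πpow τ ε⁺ m (fromℕ n) ≡ fromℕ n
  orbit-top zero    = refl
  orbit-top (suc m) = trans (cong (lookup τ) (orbit-top m)) (insertPerm-nothing-fromℕ π)

  isCycleMin-inject₁ : ∀ i → isCycleMin τ ε⁺ (inject₁ i) ≡ isCycleMin π ε i
  isCycleMin-inject₁ i = bool-ext
    (λ h → Oσ.isCycleMin⁺ i λ m → subst₂ _≤_ (Finₚ.toℕ-inject₁ i) (Finₚ.toℕ-inject₁ _)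
      (subst (λ z → toℕ (inject₁ i) ≤ toℕ z) (orbit-inject₁ i m) (Oτ.isCycleMin⁻ τ-injective (inject₁ i) h m)))
    (λ h → Oτ.isCycleMin⁺ (inject₁ i) λ m → subst (λ z → toℕ (inject₁ i) ≤ toℕ z) (sym (orbit-inject₁ i m))
      (subst₂ _≤_ (sym (Finₚ.toℕ-inject₁ i)) (sym (Finₚ.toℕ-inject₁ _)) (Oσ.isCycleMin⁻ inj i h m)))

  isCycleMin-top : isCycleMin τ ε⁺ (fromℕ n) ≡ true
  isCycleMin-top = Oτ.isCycleMin⁺ (fromℕ n) λ m → subst (λ z → toℕ (fromℕ n) ≤ toℕ z) (sym (orbit-top m)) ℕₚ.≤-refl

  cyc-insert-nothing : cyc τ ε⁺ ≡ cyc π ε + 1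
  cyc-insert-nothing = trans (countB-allFin-suc (isCycleMin τ ε⁺) (isCycleMin π ε) isCycleMin-inject₁)
                             (cong (λ z → cyc π ε + ⟦ z ⟧) isCycleMin-top)

𝟙 : {P : Set} → Dec P → ℕ
𝟙 d = ⟦ does d ⟧

Enumerates : DecidableEquality X → List X → Set
Enumerates {X} _≟ˣ_ L = ∀ (a : X) → ∑[ x ∈ L ] 𝟙 (x ≟ˣ a) ≡ 1

𝟙-⇔ : ∀ {P Q : Set} (p : Dec P) (q : Dec Q) → (P → Q) → (Q → P) → 𝟙 p ≡ 𝟙 q
𝟙-⇔ (yes _) (yes _) _ _ = refl
𝟙-⇔ (yes p) (no ¬q) f _ = ⊥-elim (¬q (f p))
𝟙-⇔ (no ¬p) (yes q) _ g = ⊥-elim (¬p (g q))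
𝟙-⇔ (no _)  (no _)  _ _ = refl

𝟙-× : ∀ {P Q R : Set} (r : Dec R) (p : Dec P) (q : Dec Q) → (R → P) → (R → Q) → (P → Q → R) → 𝟙 r ≡ 𝟙 p * 𝟙 q
𝟙-× (yes r) (yes _) (yes _) _ _ _ = refl
𝟙-× (yes r) (no ¬p) _       f _ _ = ⊥-elim (¬p (f r))
𝟙-× (yes r) (yes _) (no ¬q) _ g _ = ⊥-elim (¬q (g r))
𝟙-× (no ¬r) (yes p) (yes q) _ _ h = ⊥-elim (¬r (h p q))
𝟙-× (no _)  (no _)  _       _ _ _ = refl
𝟙-× (no _)  (yes _) (no _)  _ _ _ = refl

enumerates-combine : ∀ {Z : Set} (_≟ˣ_ : DecidableEquality X) (_≟ʸ_ : DecidableEquality Y) (_≟ᶻ_ : DecidableEquality Z)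
  (c : X → Y → Z) (L : List X) (M : List Y) → Enumerates _≟ˣ_ L → Enumerates _≟ʸ_ M →
  (∀ x y x₀ y₀ → 𝟙 (c x y ≟ᶻ c x₀ y₀) ≡ 𝟙 (x ≟ˣ x₀) * 𝟙 (y ≟ʸ y₀)) →
  ∀ x₀ y₀ → ∑[ z ∈ concatMap (λ x → map (c x) M) L ] 𝟙 (z ≟ᶻ c x₀ y₀) ≡ 1
enumerates-combine _≟ˣ_ _≟ʸ_ _≟ᶻ_ c L M enumL enumM 𝟙-c x₀ y₀ = begin
  ∑[ z ∈ concatMap (λ x → map (c x) M) L ] 𝟙 (z ≟ᶻ c x₀ y₀)  ≡⟨ ∑-concatMap _ L _ ⟩
  ∑[ x ∈ L ] ∑[ z ∈ map (c x) M ] 𝟙 (z ≟ᶻ c x₀ y₀)           ≡⟨ ∑-cong L inner ⟩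
  ∑[ x ∈ L ] (𝟙 (x ≟ˣ x₀) * ∑[ y ∈ M ] 𝟙 (y ≟ʸ y₀))          ≡⟨ ∑-cong L (λ x → cong (𝟙 (x ≟ˣ x₀) *_) (enumM y₀)) ⟩
  ∑[ x ∈ L ] (𝟙 (x ≟ˣ x₀) * 1)                              ≡⟨ ∑-cong L (λ x → ℕₚ.*-identityʳ _) ⟩
  ∑[ x ∈ L ] 𝟙 (x ≟ˣ x₀)                                    ≡⟨ enumL x₀ ⟩
  1                                                        ∎
  where
  open ≡-Reasoning
  inner : ∀ x → ∑[ z ∈ map (c x) M ] 𝟙 (z ≟ᶻ c x₀ y₀) ≡ 𝟙 (x ≟ˣ x₀) * ∑[ y ∈ M ] 𝟙 (y ≟ʸ y₀)
  inner x = trans (∑-map (c x) M _) (trans (∑-cong M (λ y → 𝟙-c x y x₀ y₀)) (∑-*ˡ M (λ y → 𝟙 (y ≟ʸ y₀)) (𝟙 (x ≟ˣ x₀))))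

enumerates-× : ∀ (_≟ˣ_ : DecidableEquality X) (_≟ʸ_ : DecidableEquality Y) (L : List X) (M : List Y) →
  Enumerates _≟ˣ_ L → Enumerates _≟ʸ_ M → Enumerates (Productₚ.≡-dec _≟ˣ_ _≟ʸ_) (concatMap (λ x → map (x ,_) M) L)
enumerates-× _≟ˣ_ _≟ʸ_ L M enumL enumM (x₀ , y₀) =
  enumerates-combine _≟ˣ_ _≟ʸ_ (Productₚ.≡-dec _≟ˣ_ _≟ʸ_) _,_ L M enumL enumM
    (λ x y x₀ y₀ → 𝟙-× (Productₚ.≡-dec _≟ˣ_ _≟ʸ_ (x , y) (x₀ , y₀)) (x ≟ˣ x₀) (y ≟ʸ y₀)
                       (cong proj₁) (cong proj₂) (cong₂ _,_))
    x₀ y₀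

enumerates-allVecs : ∀ (_≟ˣ_ : DecidableEquality X) (L : List X) → Enumerates _≟ˣ_ L →
                     ∀ k → Enumerates (Vecₚ.≡-dec _≟ˣ_) (allVecs k L)
enumerates-allVecs _≟ˣ_ L enumL zero    []       = refl
enumerates-allVecs _≟ˣ_ L enumL (suc k) (x₀ ∷ v₀) =
  enumerates-combine _≟ˣ_ (Vecₚ.≡-dec _≟ˣ_) (Vecₚ.≡-dec _≟ˣ_) _∷_ L (allVecs k L)
    enumL (enumerates-allVecs _≟ˣ_ L enumL k)
    (λ x v x₀ v₀ → 𝟙-× (Vecₚ.≡-dec _≟ˣ_ (x ∷ v) (x₀ ∷ v₀)) (x ≟ˣ x₀) (Vecₚ.≡-dec _≟ˣ_ v v₀)
                      Vecₚ.∷-injectiveˡ Vecₚ.∷-injectiveʳ (cong₂ _∷_))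
    x₀ v₀

enumerates-allFin : ∀ n → Enumerates (_≟_ {n}) (List.allFin n)
enumerates-allFin n i = trans (∑-tabulate id (λ x → 𝟙 (x ≟ i))) (go i)
  where
  go : ∀ {n} (i : Fin n) → sum (λ x → 𝟙 (x ≟ i)) ≡ 1
  go {suc n} zero    = cong suc (sum-replicate-zero n)
  go {suc n} (suc i) = trans (sum-cong-≗ (λ x → 𝟙-⇔ (suc x ≟ suc i) (x ≟ i) Finₚ.suc-injective (cong suc))) (go i)

enumerates-Bool : ∀ b → Enumerates Boolₚ._≟_ (b ∷ not b ∷ [])
enumerates-Bool false false = refl
enumerates-Bool false true  = refl
enumerates-Bool true  false = refl
enumerates-Bool true  true  = refl

enumerates-Maybe : ∀ n → Enumerates (Maybeₚ.≡-dec (_≟_ {n})) (nothing ∷ map just (List.allFin n))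
enumerates-Maybe n nothing = cong suc (trans (∑-map just (List.allFin n) _) (∑-zero′ (List.allFin n)))
  where
  ∑-zero′ : ∀ (L : List (Fin n)) → ∑[ x ∈ L ] 𝟙 (Maybeₚ.≡-dec _≟_ (just x) nothing) ≡ 0
  ∑-zero′ []      = refl
  ∑-zero′ (_ ∷ L) = ∑-zero′ L
enumerates-Maybe n (just i) = trans (∑-map just (List.allFin n) _)
  (trans (∑-cong (List.allFin n) just≟just) (enumerates-allFin n i))
  where
  just≟just : ∀ x → 𝟙 (Maybeₚ.≡-dec _≟_ (just x) (just i)) ≡ 𝟙 (x ≟ i)
  just≟just x = 𝟙-⇔ (Maybeₚ.≡-dec _≟_ (just x) (just i)) (x ≟ i) Maybeₚ.just-injective (cong just)

choices : ∀ n → List (Choice n)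
choices n = concatMap (λ c → map (c ,_) (false ∷ true ∷ [])) (nothing ∷ map just (List.allFin n))

_≟ᶜ_ : ∀ {n} → DecidableEquality (Choice n)
_≟ᶜ_ = Productₚ.≡-dec (Maybeₚ.≡-dec _≟_) Boolₚ._≟_

enumerates-choices : ∀ n → Enumerates _≟ᶜ_ (choices n)
enumerates-choices n = enumerates-× (Maybeₚ.≡-dec _≟_) Boolₚ._≟_ (nothing ∷ map just (List.allFin n)) (false ∷ true ∷ [])
  (enumerates-Maybe n) (enumerates-Bool false)

candidates : ∀ n → List (SignedPerm n)
candidates n = concatMap (λ π → map (π ,_) (signs n)) (allVecs n (List.allFin n))

_≟ˢ_ : ∀ {n} → DecidableEquality (SignedPerm n)
_≟ˢ_ = Productₚ.≡-dec (Vecₚ.≡-dec _≟_) (Vecₚ.≡-dec Boolₚ._≟_)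

enumerates-candidates : ∀ n → Enumerates _≟ˢ_ (candidates n)
enumerates-candidates n = enumerates-× (Vecₚ.≡-dec _≟_) (Vecₚ.≡-dec Boolₚ._≟_) (allVecs n (List.allFin n)) (signs n)
  (enumerates-allVecs _≟_ _ (enumerates-allFin n) n) (enumerates-allVecs Boolₚ._≟_ _ (enumerates-Bool true) n)

candidatesWithChoice : ∀ n → List (SignedPerm n × Choice n)
candidatesWithChoice n = concatMap (λ σ → map (σ ,_) (choices n)) (candidates n)

enumerates-candidatesWithChoice : ∀ n → Enumerates (Productₚ.≡-dec _≟ˢ_ _≟ᶜ_) (candidatesWithChoice n)
enumerates-candidatesWithChoice n =
  enumerates-× _≟ˢ_ _≟ᶜ_ (candidates n) (choices n) (enumerates-candidates n) (enumerates-choices n)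

module Reindex {X Y : Set} (_≟ˣ_ : DecidableEquality X) (_≟ʸ_ : DecidableEquality Y)
  (L : List X) (M : List Y) (enumL : Enumerates _≟ˣ_ L) (enumM : Enumerates _≟ʸ_ M)
  (P : X → Bool) (Q : Y → Bool) (f : Y → X) (g : X → Y)
  (f-Q : ∀ y → Q y ≡ true → P (f y) ≡ true) (g∘f : ∀ y → Q y ≡ true → g (f y) ≡ y)
  (g-P : ∀ x → P x ≡ true → Q (g x) ≡ true) (f∘g : ∀ x → P x ≡ true → f (g x) ≡ x) where

  pointwise : ∀ (G : X → ℕ) x y → restrict (P x) (G x) * 𝟙 (y ≟ʸ g x) ≡ restrict (Q y) (G (f y)) * 𝟙 (x ≟ˣ f y)
  pointwise G x y with P x in Px | y ≟ʸ g x
  ... | true  | yes refl rewrite g-P x Px | f∘g x Px with x ≟ˣ x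
  ...   | yes _  = refl
  ...   | no x≢x = ⊥-elim (x≢x refl)
  pointwise G x y | true  | no y≢gx = trans (ℕₚ.*-zeroʳ (G x)) (sym (vanish (Q y) refl (x ≟ˣ f y)))
    where
    vanish : ∀ c → Q y ≡ c → (d : Dec (x ≡ f y)) → restrict c (G (f y)) * 𝟙 d ≡ 0
    vanish true  Qy (yes refl) = ⊥-elim (y≢gx (sym (g∘f y Qy)))
    vanish true  Qy (no _)     = ℕₚ.*-zeroʳ (G (f y))
    vanish false Qy d          = refl
  pointwise G x y | false | _ = sym (vanish (Q y) refl (x ≟ˣ f y))
    where
    vanish : ∀ c → Q y ≡ c → (d : Dec (x ≡ f y)) → restrict c (G (f y)) * 𝟙 d ≡ 0
    vanish true  Qy (yes refl) with () ← trans (sym Px) (f-Q y Qy)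
    vanish true  Qy (no _)     = ℕₚ.*-zeroʳ (G (f y))
    vanish false Qy d          = refl

  -- Both sides are the sum of G x over the pairs (x , y) ∈ L × M with y = g x, i.e. x = f y.
  reindex : ∀ (G : X → ℕ) → ∑[ x ∈ L ] restrict (P x) (G x) ≡ ∑[ y ∈ M ] restrict (Q y) (G (f y))
  reindex G = begin
    ∑[ x ∈ L ] restrict (P x) (G x)
      ≡⟨ ∑-cong L (λ x → sym (trans (cong (restrict (P x) (G x) *_) (enumM (g x))) (ℕₚ.*-identityʳ _))) ⟩
    ∑[ x ∈ L ] (restrict (P x) (G x) * ∑[ y ∈ M ] 𝟙 (y ≟ʸ g x))
      ≡⟨ ∑-cong L (λ x → sym (∑-*ˡ M (λ y → 𝟙 (y ≟ʸ g x)) (restrict (P x) (G x)))) ⟩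
    ∑[ x ∈ L ] ∑[ y ∈ M ] (restrict (P x) (G x) * 𝟙 (y ≟ʸ g x))
      ≡⟨ ∑-cong L (λ x → ∑-cong M (pointwise G x)) ⟩
    ∑[ x ∈ L ] ∑[ y ∈ M ] (restrict (Q y) (G (f y)) * 𝟙 (x ≟ˣ f y))
      ≡⟨ ∑-comm L M _ ⟩
    ∑[ y ∈ M ] ∑[ x ∈ L ] (restrict (Q y) (G (f y)) * 𝟙 (x ≟ˣ f y))
      ≡⟨ ∑-cong M (λ y → trans (∑-*ˡ L (λ x → 𝟙 (x ≟ˣ f y)) (restrict (Q y) (G (f y)))) (collapse (f y) _)) ⟩
    ∑[ y ∈ M ] restrict (Q y) (G (f y)) ∎
    where
    open ≡-Reasoning
    collapse : ∀ x₀ c → c * ∑[ x ∈ L ] 𝟙 (x ≟ˣ x₀) ≡ c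
    collapse x₀ c = trans (cong (c *_) (enumL x₀)) (ℕₚ.*-identityʳ c)

infix 4 _≡ˢ_

_≡ˢ_ : Status → Status → Bool
excedance     ≡ˢ excedance     = true
antiExcedance ≡ˢ antiExcedance = true
fixedPoint    ≡ˢ fixedPoint    = true
singleton     ≡ˢ singleton     = true
_             ≡ˢ _             = false

signed-injective : ∀ e e′ m m′ → signed e m ≡ signed e′ m′ → m ≡ m′
signed-injective true  true  m m′ q = ℤₚ.-[1+-injective q
signed-injective false false m m′ q = ℕₚ.suc-injective (ℤₚ.+-injective q)

module Classify (π : Vec (Fin n) n) (ε : Vec Bool n) (inj : Injective _≡_ _≡_ (lookup π)) (k : Fin n) where
  a = σ π ε k
  c = σσ π ε k

  -- a = ±k forces |σ(k)| = k, hence a = c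
  fixed⇒a≡c : ∀ e → a ≡ signed e (toℕ k) → a ≡ c
  fixed⇒a≡c e q = cong (σ π ε) (sym (Finₚ.toℕ-injective (signed-injective (lookup ε k) e _ _ q)))

  notFixedPoint : a ≢ c → holds fixedPoint a c (toℕ k) ≡ false
  notFixedPoint a≢c = dec-false (a ℤ.≟ _) (a≢c ∘ fixed⇒a≡c false)

  notSingleton : a ≢ c → holds singleton a c (toℕ k) ≡ false
  notSingleton a≢c = dec-false (a ℤ.≟ _) (a≢c ∘ fixed⇒a≡c true)

  classify : ∃ λ S → ∀ S′ → hasStatus S′ π ε k ≡ (S′ ≡ˢ S)
  classify with ℤₚ.<-cmp a c
  ... | tri< a<c a≢c _ = excedance , λ
    { excedance     → dec-true (a ℤ.<? c) a<c
    ; antiExcedance → dec-false (c ℤ.<? a) (ℤₚ.<-asym a<c)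
    ; fixedPoint    → notFixedPoint a≢c
    ; singleton     → notSingleton a≢c }
  ... | tri> _ a≢c c<a = antiExcedance , λ
    { excedance     → dec-false (a ℤ.<? c) (ℤₚ.<-asym c<a)
    ; antiExcedance → dec-true (c ℤ.<? a) c<a
    ; fixedPoint    → notFixedPoint a≢c
    ; singleton     → notSingleton a≢c }
  ... | tri≈ _ a≡c _ = fixedOrSingleton (lookup ε k) refl
    where
    πk≡k : lookup π k ≡ k
    πk≡k = sym (inj (Finₚ.toℕ-injective (signed-injective (lookup ε k) (lookup ε (lookup π k)) _ _ a≡c)))

    a≡±k : ∀ e → lookup ε k ≡ e → a ≡ signed e (toℕ k)
    a≡±k e q = cong₂ signed q (cong toℕ πk≡k)

    not< : ∀ x y → x ≡ y → does (x ℤ.<? y) ≡ false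
    not< x .x refl = <?-irrefl x

    fixedOrSingleton : ∀ e → lookup ε k ≡ e → ∃ λ S → ∀ S′ → hasStatus S′ π ε k ≡ (S′ ≡ˢ S)
    fixedOrSingleton false q = fixedPoint , λ
      { excedance     → not< a c a≡c
      ; antiExcedance → not< c a (sym a≡c)
      ; fixedPoint    → dec-true (a ℤ.≟ _) (a≡±k false q)
      ; singleton     → dec-false (a ℤ.≟ _) (λ a≡- → +≢- (trans (sym (a≡±k false q)) a≡-)) }
      where +≢- : ∀ {x y} → ℤ.+ suc x ≢ -[1+ y ]
            +≢- ()
    fixedOrSingleton true  q = singleton , λ
      { excedance     → not< a c a≡c
      ; antiExcedance → not< c a (sym a≡c)
      ; fixedPoint    → dec-false (a ℤ.≟ _) (λ a≡+ → -≢+ (trans (sym (a≡±k true q)) a≡+))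
      ; singleton     → dec-true (a ℤ.≟ _) (a≡±k true q) }
      where -≢+ : ∀ {x y} → -[1+ x ] ≢ ℤ.+ suc y
            -≢+ ()

mon-cong : ∀ {a b c d e f g a′ b′ c′ d′ e′ f′ g′ : ℕ} →
  a ≡ a′ → b ≡ b′ → c ≡ c′ → d ≡ d′ → e ≡ e′ → f ≡ f′ → g ≡ g′ →
  _≡_ {A = Mon} (a ∷ b ∷ c ∷ d ∷ e ∷ f ∷ g ∷ []) (a′ ∷ b′ ∷ c′ ∷ d′ ∷ e′ ∷ f′ ∷ g′ ∷ [])
mon-cong refl refl refl refl refl refl refl = refl

Jweight : SignedPerm n → Mon
Jweight σ = Jᵐ +ᵐ uncurry weight σ

lowered : Status → Mon → Mon
lowered S (a ∷ f ∷ s ∷ x ∷ y ∷ c ∷ g ∷ []) =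
  a ∷ f ∸ ⟦ fixedPoint ≡ˢ S ⟧ ∷ s ∸ ⟦ singleton ≡ˢ S ⟧ ∷ x ∸ ⟦ excedance ≡ˢ S ⟧ ∷ y ∸ ⟦ antiExcedance ≡ˢ S ⟧ ∷ c ∷ g ∷ []

hasStatus≤count : ∀ S (π : Vec (Fin n) n) ε i → ⟦ hasStatus S π ε i ⟧ ≤ count S π ε
hasStatus≤count {suc n} S π ε i =
  subst (⟦ hasStatus S π ε i ⟧ ≤_) (sym (trans (count≡sum S π ε) (sum-remove {i = i} summand))) (ℕₚ.m≤m+n _ _)
  where
  summand : Fin (suc n) → ℕ
  summand j = ⟦ hasStatus S π ε j ⟧

m+b≡c+X⇒m≡X+[c∸b] : ∀ {m b c X} → m + b ≡ c + X → b ≤ c → m ≡ X + (c ∸ b)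
m+b≡c+X⇒m≡X+[c∸b] {m} {b} {c} {X} e b≤c = begin
  m             ≡⟨ ℕₚ.m+n∸n≡m m b ⟨
  m + b ∸ b     ≡⟨ cong (_∸ b) (trans e (ℕₚ.+-comm c X)) ⟩
  X + c ∸ b     ≡⟨ ℕₚ.+-∸-assoc X b≤c ⟩
  X + (c ∸ b)   ∎
  where open ≡-Reasoning

module _ (π : Vec (Fin n) n) (ε : Vec Bool n) (inj : Injective _≡_ _≡_ (lookup π)) where
  private
    nF  = count fixedPoint π ε
    nS = count singleton π ε
    nX  = count excedance π ε
    nY  = count antiExcedance π ε
    nC  = cyc π ε
    nN  = neg π ε

  Jweight-insert-fixedPoint : Jweight (insert ((π , ε) , (nothing , false))) ≡
                              1 ∷ suc nF ∷ nS ∷ nX ∷ nY ∷ suc nC ∷ nN ∷ []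
  Jweight-insert-fixedPoint = mon-cong refl
    (trans (count-insert-nothing fixedPoint) (ℕₚ.+-comm nF 1))
    (trans (count-insert-nothing singleton) (ℕₚ.+-identityʳ nS))
    (trans (count-insert-nothing excedance) (ℕₚ.+-identityʳ nX))
    (trans (count-insert-nothing antiExcedance) (ℕₚ.+-identityʳ nY))
    (trans cyc-insert-nothing (ℕₚ.+-comm nC 1)) (trans neg-insert-nothing (ℕₚ.+-identityʳ nN))
    where open InsertNothing π ε false
          open CycleInsertNothing π ε inj false

  Jweight-insert-singleton : Jweight (insert ((π , ε) , (nothing , true))) ≡
                             1 ∷ nF ∷ suc nS ∷ nX ∷ nY ∷ suc nC ∷ suc nN ∷ []
  Jweight-insert-singleton = mon-cong refl
    (trans (count-insert-nothing fixedPoint) (ℕₚ.+-identityʳ nF))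
    (trans (count-insert-nothing singleton) (ℕₚ.+-comm nS 1))
    (trans (count-insert-nothing excedance) (ℕₚ.+-identityʳ nX))
    (trans (count-insert-nothing antiExcedance) (ℕₚ.+-identityʳ nY))
    (trans cyc-insert-nothing (ℕₚ.+-comm nC 1)) (trans neg-insert-nothing (ℕₚ.+-comm nN 1))
    where open InsertNothing π ε true
          open CycleInsertNothing π ε inj true

  module _ (k : Fin n) (S : Status) (status : ∀ S′ → hasStatus S′ π ε k ≡ (S′ ≡ˢ S)) (b : Bool) where
    open InsertJust π ε inj k b
    open CycleInsertJust π ε inj k b using (cyc-insert-just)

    count-after : ∀ S′ → count S′ τ ε⁺ ≡ ⟦ isExcOrAexc S′ ⟧ + (count S′ π ε ∸ ⟦ S′ ≡ˢ S ⟧)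
    count-after S′ = m+b≡c+X⇒m≡X+[c∸b]
      (subst (λ h → count S′ τ ε⁺ + ⟦ h ⟧ ≡ _) (status S′) (count-insert-just S′))
      (subst (λ h → ⟦ h ⟧ ≤ _) (status S′) (hasStatus≤count S′ π ε k))

    -- The letter recording the status of k becomes x y, times q if the arrow j → n+1 is negative.
    Jweight-insert-just : Jweight (insert ((π , ε) , (just k , b))) ≡
                          (0 ∷ 0 ∷ 0 ∷ 1 ∷ 1 ∷ 0 ∷ ⟦ b ⟧ ∷ []) +ᵐ lowered S (Jweight (π , ε))
    Jweight-insert-just = mon-cong refl (count-after fixedPoint) (count-after singleton)
      (count-after excedance) (count-after antiExcedance) cyc-insert-just (trans neg-insert-just (ℕₚ.+-comm nN ⟦ b ⟧))

statuses : List Status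
statuses = fixedPoint ∷ singleton ∷ excedance ∷ antiExcedance ∷ []

∑-statuses-select : ∀ S₀ (f : Status → ℕ) → ∑[ S ∈ statuses ] (⟦ S ≡ˢ S₀ ⟧ * f S) ≡ f S₀
∑-statuses-select fixedPoint    f = trans (ℕₚ.+-identityʳ _) (ℕₚ.+-identityʳ _)
∑-statuses-select singleton     f = trans (ℕₚ.+-identityʳ _) (ℕₚ.+-identityʳ _)
∑-statuses-select excedance     f = trans (ℕₚ.+-identityʳ _) (ℕₚ.+-identityʳ _)
∑-statuses-select antiExcedance f = trans (ℕₚ.+-identityʳ _) (ℕₚ.+-identityʳ _)

module _ (π : Vec (Fin n) n) (ε : Vec Bool n) (inj : Injective _≡_ _≡_ (lookup π)) (v : Mon) where
  private
    m = Jweight (π , ε)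
    hits : Mon → ℕ
    hits w = 𝟙 (Vecₚ.≡-dec ℕ._≟_ w v)
    ∂stxy-part : Status → ℕ
    ∂stxy-part S = multiplicity (∂stxy ⊗ᵐ lowered S m) v
    inserted : Choice n → ℕ
    inserted c = hits (Jweight (insert ((π , ε) , c)))

  inserted-nothing : inserted (nothing , false) + (inserted (nothing , true) + 0) ≡ multiplicity (∂J ⊗ᵐ weight π ε) v
  inserted-nothing =
    cong₂ (λ a b → hits a + (hits b + 0)) (Jweight-insert-fixedPoint π ε inj) (Jweight-insert-singleton π ε inj)

  inserted-just : ∀ k → inserted (just k , false) + (inserted (just k , true) + 0) ≡
                        ∑[ S ∈ statuses ] (⟦ hasStatus S π ε k ⟧ * ∂stxy-part S)
  inserted-just k with S₀ , status ← Classify.classify π ε inj k = begin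
    inserted (just k , false) + (inserted (just k , true) + 0)
      ≡⟨ cong₂ (λ a b → hits a + (hits b + 0)) (Jweight-insert-just π ε inj k S₀ status false)
                                               (Jweight-insert-just π ε inj k S₀ status true) ⟩
    ∂stxy-part S₀                                          ≡⟨ ∑-statuses-select S₀ ∂stxy-part ⟨
    ∑[ S ∈ statuses ] (⟦ S ≡ˢ S₀ ⟧ * ∂stxy-part S)
      ≡⟨ ∑-cong statuses (λ S → cong (λ h → ⟦ h ⟧ * ∂stxy-part S) (status S)) ⟨
    ∑[ S ∈ statuses ] (⟦ hasStatus S π ε k ⟧ * ∂stxy-part S) ∎
    where open ≡-Reasoning

  multiplicity-∂-Jweight : multiplicity (∂ m) v ≡
    1 * multiplicity (∂J ⊗ᵐ weight π ε) v + ∑[ S ∈ statuses ] (count S π ε * ∂stxy-part S)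
  multiplicity-∂-Jweight = multiplicity-unfold (∂-blocks m) v

  multiplicity-∂-insert : multiplicity (∂ m) v ≡ multiplicity (map (λ c → Jweight (insert ((π , ε) , c))) (choices n)) v
  multiplicity-∂-insert = sym (begin
    multiplicity (map (λ c → Jweight (insert ((π , ε) , c))) (choices n)) v
      ≡⟨ trans (∑-map (λ c → Jweight (insert ((π , ε) , c))) (choices n) hits)
               (∑-concatMap (λ c → map (c ,_) (false ∷ true ∷ [])) (nothing ∷ map just (List.allFin n)) inserted) ⟩
    (inserted (nothing , false) + (inserted (nothing , true) + 0)) +
      ∑[ c ∈ map just (List.allFin n) ] (inserted (c , false) + (inserted (c , true) + 0))
      ≡⟨ cong₂ _+_ inserted-nothing (trans (∑-map just (List.allFin n) _) (∑-cong (List.allFin n) inserted-just)) ⟩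
    multiplicity (∂J ⊗ᵐ weight π ε) v + ∑[ k ∈ List.allFin n ] ∑[ S ∈ statuses ] (⟦ hasStatus S π ε k ⟧ * ∂stxy-part S)
      ≡⟨ cong₂ _+_ (sym (ℕₚ.+-identityʳ _)) (trans (∑-comm (List.allFin n) statuses term) (∑-cong statuses per-status)) ⟩
    1 * multiplicity (∂J ⊗ᵐ weight π ε) v + ∑[ S ∈ statuses ] (count S π ε * ∂stxy-part S)
      ≡⟨ multiplicity-∂-Jweight ⟨
    multiplicity (∂ m) v ∎)
    where
    open ≡-Reasoning
    term : Fin n → Status → ℕ
    term k S = ⟦ hasStatus S π ε k ⟧ * ∂stxy-part S
    per-status : ∀ S → ∑[ k ∈ List.allFin n ] (⟦ hasStatus S π ε k ⟧ * ∂stxy-part S) ≡ count S π ε * ∂stxy-part S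
    per-status S = trans (∑-*ʳ (List.allFin n) (λ k → ⟦ hasStatus S π ε k ⟧) (∂stxy-part S))
                         (cong (_* ∂stxy-part S) (sym (countB≡∑ (hasStatus S π ε) (List.allFin n))))

-- Summing over B_{n+1}

∑-signedPerms : ∀ N (G : SignedPerm N → ℕ) → ∑ (signedPerms N) G ≡ ∑[ σ ∈ candidates N ] restrict (isPerm (proj₁ σ)) (G σ)
∑-signedPerms N G = begin
  ∑ (signedPerms N) G                                                    ≡⟨ ∑-concatMap pair (perms N) G ⟩
  ∑[ π ∈ perms N ] ∑ (pair π) G                                          ≡⟨ ∑-filter isPerm vectors _ ⟩
  ∑[ π ∈ vectors ] restrict (isPerm π) (∑ (pair π) G)                    ≡⟨ ∑-cong vectors restrict-pair ⟩
  ∑[ π ∈ vectors ] ∑[ σ ∈ pair π ] restrict (isPerm (proj₁ σ)) (G σ)     ≡⟨ ∑-concatMap pair vectors _ ⟨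
  ∑[ σ ∈ candidates N ] restrict (isPerm (proj₁ σ)) (G σ)                ∎
  where
  open ≡-Reasoning
  vectors = allVecs N (List.allFin N)
  pair : Vec (Fin N) N → List (SignedPerm N)
  pair π = map (π ,_) (signs N)
  restrict-pair : ∀ π → restrict (isPerm π) (∑ (pair π) G) ≡ ∑[ σ ∈ pair π ] restrict (isPerm (proj₁ σ)) (G σ)
  restrict-pair π = begin
    restrict (isPerm π) (∑ (pair π) G)                       ≡⟨ cong (restrict (isPerm π)) (∑-map (π ,_) (signs N) G) ⟩
    restrict (isPerm π) (∑[ ε ∈ signs N ] G (π , ε))         ≡⟨ restrict-∑ (isPerm π) (signs N) _ ⟩
    ∑[ ε ∈ signs N ] restrict (isPerm π) (G (π , ε))         ≡⟨ ∑-map (π ,_) (signs N) _ ⟨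
    ∑[ σ ∈ pair π ] restrict (isPerm (proj₁ σ)) (G σ)        ∎

∑-signedPerms-cong : ∀ N (F G : SignedPerm N → ℕ) → (∀ σ → isPerm (proj₁ σ) ≡ true → F σ ≡ G σ) →
                     ∑ (signedPerms N) F ≡ ∑ (signedPerms N) G
∑-signedPerms-cong N F G F≗G = trans (∑-signedPerms N F)
  (trans (∑-cong (candidates N) (λ σ → restrict-cong σ (isPerm (proj₁ σ)) refl)) (sym (∑-signedPerms N G)))
  where
  restrict-cong : ∀ σ c → isPerm (proj₁ σ) ≡ c → restrict c (F σ) ≡ restrict c (G σ)
  restrict-cong σ true  perm = F≗G σ perm
  restrict-cong σ false _    = refl

∑-insert : ∀ n (G : SignedPerm (suc n) → ℕ) →
           ∑[ σ ∈ signedPerms n ] ∑[ c ∈ choices n ] G (insert (σ , c)) ≡ ∑ (signedPerms (suc n)) G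
∑-insert n G = begin
  ∑[ σ ∈ signedPerms n ] ∑[ c ∈ choices n ] G (insert (σ , c))
    ≡⟨ ∑-signedPerms n _ ⟩
  ∑[ σ ∈ candidates n ] restrict (isPerm (proj₁ σ)) (∑[ c ∈ choices n ] G (insert (σ , c)))
    ≡⟨ ∑-cong (candidates n) (λ σ → trans (restrict-∑ (isPerm (proj₁ σ)) (choices n) (G ∘′ insert ∘′ (σ ,_)))
                                              (sym (∑-map (σ ,_) (choices n) restricted))) ⟩
  ∑[ σ ∈ candidates n ] ∑ (map (σ ,_) (choices n)) restricted
    ≡⟨ ∑-concatMap (λ σ → map (σ ,_) (choices n)) (candidates n) restricted ⟨
  ∑ (candidatesWithChoice n) restricted
    ≡⟨ reindex G ⟨
  ∑[ τ ∈ candidates (suc n) ] restrict (isPerm (proj₁ τ)) (G τ)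
    ≡⟨ ∑-signedPerms (suc n) G ⟨
  ∑ (signedPerms (suc n)) G ∎
  where
  open ≡-Reasoning
  open Reindex _≟ˢ_ (Productₚ.≡-dec _≟ˢ_ _≟ᶜ_) (candidates (suc n)) (candidatesWithChoice n)
    (enumerates-candidates (suc n)) (enumerates-candidatesWithChoice n)
    (isPerm ∘′ proj₁) (isPerm ∘′ proj₁ ∘′ proj₁) insert remove
    isPerm-insert remove-insert
    isPerm-remove insert-remove
    using (reindex)
  restricted : SignedPerm n × Choice n → ℕ
  restricted b = restrict (isPerm (proj₁ (proj₁ b))) (G (insert b))

multiplicity-∂-JB : ∀ n v → multiplicity (concatMap ∂ (map Jweight (signedPerms n))) v ≡
                            multiplicity (map Jweight (signedPerms (suc n))) v
multiplicity-∂-JB n v = begin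
  multiplicity (concatMap ∂ (map Jweight (signedPerms n))) v
    ≡⟨ ∑-concatMap ∂ (map Jweight (signedPerms n)) hits ⟩
  ∑[ m ∈ map Jweight (signedPerms n) ] multiplicity (∂ m) v
    ≡⟨ ∑-map Jweight (signedPerms n) (λ m → multiplicity (∂ m) v) ⟩
  ∑[ σ ∈ signedPerms n ] multiplicity (∂ (Jweight σ)) v
    ≡⟨ ∑-signedPerms-cong n _ _ (λ { (π , ε) perm → multiplicity-∂-insert π ε (isPerm⇒injective π perm) v }) ⟩
  ∑[ σ ∈ signedPerms n ] multiplicity (map (λ c → Jweight (insert (σ , c))) (choices n)) v
    ≡⟨ ∑-cong (signedPerms n) (λ σ → ∑-map (λ c → Jweight (insert (σ , c))) (choices n) hits) ⟩
  ∑[ σ ∈ signedPerms n ] ∑[ c ∈ choices n ] hits (Jweight (insert (σ , c)))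
    ≡⟨ ∑-insert n (hits ∘′ Jweight) ⟩
  ∑[ τ ∈ signedPerms (suc n) ] hits (Jweight τ)
    ≡⟨ ∑-map Jweight (signedPerms (suc n)) hits ⟨
  multiplicity (map Jweight (signedPerms (suc n))) v ∎
  where
  open ≡-Reasoning
  hits : Mon → ℕ
  hits w = 𝟙 (Vecₚ.≡-dec ℕ._≟_ w v)

J⊗B≡monomials : ∀ n → J ⊗ B n ≡ monomials (map Jweight (signedPerms n))
J⊗B≡monomials n = begin
  J ⊗ B n                                                   ≡⟨ monomial-⊗ Jᵐ (B n) ⟩
  shift Jᵐ (B n)                                            ≡⟨ cong (shift Jᵐ) (Listₚ.map-∘ (signedPerms n)) ⟩
  shift Jᵐ (monomials (map (uncurry weight) (signedPerms n)))  ≡⟨ shift-monomials Jᵐ _ ⟩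
  monomials (map (Jᵐ +ᵐ_) (map (uncurry weight) (signedPerms n))) ≡⟨ cong monomials (Listₚ.map-∘ (signedPerms n)) ⟨
  monomials (map Jweight (signedPerms n))                   ∎
  where open ≡-Reasoning

mainTheorem14 : (D : Poly → Poly) → IsDerivation D →
    D p ≈ 0P → D q ≈ 0P →
    D J ≈ p ⊗ J ⊗ (s ⊕ q ⊗ t) →
    D s ≈ (1P ⊕ q) ⊗ x ⊗ y →
    D t ≈ (1P ⊕ q) ⊗ x ⊗ y →
    D x ≈ (1P ⊕ q) ⊗ x ⊗ y →
    D y ≈ (1P ⊕ q) ⊗ x ⊗ y →
    (n : ℕ) → iter n D J ≈ J ⊗ B n
mainTheorem14 D isD Dp Dq DJ Ds Dt Dx Dy n = ≋⇒≈ (iter-D-J n)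
  where
  open IsDerivation isD
  open ≋-Reasoning

  ≋-from : ∀ {P Q R} → P ≈ Q → Q ≡ R → P ≋ R
  ≋-from P≈Q refl = ≈⇒≋ P≈Q

  D-monomials′ : ∀ L → D (monomials L) ≋ monomials (concatMap ∂ L)
  D-monomials′ = D-monomials D isD (≈⇒≋ Dp) (≈⇒≋ Dq) (≋-from DJ pJ[s+qt]≡∂J)
    (≋-from Ds [1+q]xy≡∂stxy) (≋-from Dt [1+q]xy≡∂stxy) (≋-from Dx [1+q]xy≡∂stxy) (≋-from Dy [1+q]xy≡∂stxy)

  iter-D-J : ∀ n → iter n D J ≋ J ⊗ B n
  iter-D-J zero    = ≋-refl
  iter-D-J (suc n) = begin
    D (iter n D J)                                         ≈⟨ ≈⇒≋ (D-cong (≋⇒≈ (iter-D-J n))) ⟩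
    D (J ⊗ B n)                                            ≡⟨ cong D (J⊗B≡monomials n) ⟩
    D (monomials (map Jweight (signedPerms n)))            ≈⟨ D-monomials′ (map Jweight (signedPerms n)) ⟩
    monomials (concatMap ∂ (map Jweight (signedPerms n)))  ≈⟨ monomials-cong _ _ (multiplicity-∂-JB n) ⟩
    monomials (map Jweight (signedPerms (suc n)))          ≡⟨ J⊗B≡monomials (suc n) ⟨
    J ⊗ B (suc n)                                          ∎
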